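{- For every $n\ge1$, there is a bijection between the set of directed column-convex polyominoes of area $n$ and $\mathcal{S}_n(231,3124)$.
   Context: A polyomino is a finite edge-connected set of unit square cells in the plane. It is directed if it can be built starting from a single cell by repeatedly adding a new cell immediately to the right of or immediately above an existing cell; it is column-convex if the cells in each column form a contiguous vertical segment. Its area is its number of cells. $\mathcal{S}_n(231,3124)$ is the set of permutations of $[n]$ (one-line notation) having no subsequence in the same relative order as $231$ or as $3124$. -}

module Defs where

open import Data.Nat using (ℕ)
open import Data.Integer using (ℤ; _+_; _≤_; 1ℤ; 0ℤ)
open import Data.Fin using (Fin; _<_)
open import Data.Vec using (Vec; lookup)
open import Data.List using (List; []; _∷_; length)
open import Data.List.Membership.Propositional using (_∈_; _∉_)
open import Data.List.Relation.Unary.Unique.Propositional using (Unique)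
open import Data.Product using (Σ; ∃; _×_; _,_)
open import Data.Sum using (_⊎_)
open import Relation.Binary.PropositionalEquality using (_≡_)
open import Relation.Nullary using (¬_)
open import Function.Bundles using (_⇔_)
open import Function.Definitions using (Injective)

-- A unit cell is identified by the integer coordinates (column, row)
-- of its lower-left corner.
Cell : Set
Cell = ℤ × ℤ

-- A finite set of cells is represented by a duplicate-free list.

Adjacent : Cell → Cell → Set
Adjacent (x , y) (x' , y') =
  (y ≡ y' × (x' ≡ x + 1ℤ ⊎ x ≡ x' + 1ℤ)) ⊎
  (x ≡ x' × (y' ≡ y + 1ℤ ⊎ y ≡ y' + 1ℤ))

data PathIn (L : List Cell) : Cell → Cell → Set where
  here : ∀ {c} → c ∈ L → PathIn L c c
  step : ∀ {c c' d} → c ∈ L → Adjacent c c' → PathIn L c' d → PathIn L c d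

EdgeConnected : List Cell → Set
EdgeConnected L = ∀ {c d} → c ∈ L → d ∈ L → PathIn L c d

record IsPolyomino (L : List Cell) : Set where
  field
    unique    : Unique L
    nonempty  : ∃ λ c → c ∈ L
    connected : EdgeConnected L

area : List Cell → ℕ
area = length

right : Cell → Cell
right (x , y) = (x + 1ℤ , y)

above : Cell → Cell
above (x , y) = (x , y + 1ℤ)

-- 'Built L' : the cells of L (listed newest first) arise by starting with a
-- single cell and repeatedly adding a NEW cell immediately to the right of
-- or immediately above an existing cell.
data Built : List Cell → Set where
  start : ∀ c → Built (c ∷ [])
  grow  : ∀ {c L} → Built L → c ∉ L →
          (∃ λ d → d ∈ L × (c ≡ right d ⊎ c ≡ above d)) → Built (c ∷ L)

Directed : List Cell → Set
Directed P = ∃ λ L → Built L × (∀ c → (c ∈ L) ⇔ (c ∈ P))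

ColumnConvex : List Cell → Set
ColumnConvex P = ∀ x y₁ y₂ y → (x , y₁) ∈ P → (x , y₂) ∈ P →
                 y₁ ≤ y → y ≤ y₂ → (x , y) ∈ P

DCCPolyomino : ℕ → Set
DCCPolyomino n = Σ (List Cell) λ P →
  IsPolyomino P × Directed P × ColumnConvex P × area P ≡ n

-- Polyominoes are considered up to translation.
TranslationEquivalent : List Cell → List Cell → Set
TranslationEquivalent P Q =
  ∃ λ (a : ℤ) → ∃ λ (b : ℤ) → ∀ x y → ((x , y) ∈ P) ⇔ ((x + a , y + b) ∈ Q)

_≈P_ : ∀ {n} → DCCPolyomino n → DCCPolyomino n → Set
(P , _) ≈P (Q , _) = TranslationEquivalent P Q

-- σ = σ(1) … σ(n), with values in Fin n (0-based), as a vector.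
IsPermutation : ∀ {n} → Vec (Fin n) n → Set
IsPermutation σ = Injective _≡_ _≡_ (lookup σ)

Contains231 : ∀ {n} → Vec (Fin n) n → Set
Contains231 {n} σ = ∃ λ (i : Fin n) → ∃ λ j → ∃ λ k →
  i < j × j < k ×
  lookup σ k < lookup σ i × lookup σ i < lookup σ j

Contains3124 : ∀ {n} → Vec (Fin n) n → Set
Contains3124 {n} σ = ∃ λ (i : Fin n) → ∃ λ j → ∃ λ k → ∃ λ l →
  i < j × j < k × k < l ×
  lookup σ j < lookup σ k × lookup σ k < lookup σ i × lookup σ i < lookup σ l

InS231-3124 : ∀ {n} → Vec (Fin n) n → Set
InS231-3124 σ = IsPermutation σ × ¬ Contains231 σ × ¬ Contains3124 σ

module Submission where

-- Reading a directed column-convex polyomino from its source cell, either the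
-- source is alone, or nothing lies to its right and the rest is a smaller
-- such polyomino starting just above it, or the whole source column (of some
-- height p + 1) can be removed, leaving a smaller one starting just right of
-- the source.  This recursive decomposition ('Code') determines the polyomino
-- up to translation.  On the permutation side the first case is the
-- permutation 0, the second prepends the maximum, and the third prepends the
-- run p, p − 1, …, 0 and lifts the rest above it.  Conversely, avoiding 231
-- and 3124 forces this shape: if the first value v is not the maximum, then
-- the permutation starts v, v − 1, …, 0 (a misplaced value creates a 231
-- with the first entry, or a 3124 with the first entry and the maximum), so
-- all later values exceed v.

open import Defs
open import Data.Nat using (ℕ; _≥_)
open import Data.Fin using (Fin)
open import Data.Vec using (Vec)
open import Data.Product using (Σ; ∃; _×_; _,_)
open import Relation.Binary.PropositionalEquality using (_≡_; cong; trans)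

module Codes where
  open import Data.Nat using (ℕ; suc; _+_)

  -- Codes of directed column-convex polyominoes, read from the source cell:
  -- 'under c' is the polyomino of c lifted by one row with a new source
  -- cell below it, and 'column p c' is a source column of p + 1 cells with
  -- the polyomino of c attached to the right of its bottom cell.
  data Code : Set where
    single : Code
    under  : Code → Code
    column : ℕ → Code → Code

  size : Code → ℕ
  size single       = 1
  size (under c)    = suc (size c)
  size (column p c) = suc p + size c


module PermutationsOfCodes where
  open Codes
  open import Data.Nat
  open import Data.Nat.Properties
  open import Data.Sum using (_⊎_; inj₁; inj₂)
  open import Data.Empty using (⊥; ⊥-elim)
  open import Relation.Nullary using (yes; no)
  open import Relation.Binary.PropositionalEquality

  -- Permutations of [0, n) in one-line notation are functions ℕ → ℕ
  -- considered on positions below n.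
  Bounded : ℕ → (ℕ → ℕ) → Set
  Bounded n s = ∀ i → i < n → s i < n

  InjectiveBelow : ℕ → (ℕ → ℕ) → Set
  InjectiveBelow n s = ∀ i j → i < n → j < n → s i ≡ s j → i ≡ j

  record IsS231-3124 (n : ℕ) (s : ℕ → ℕ) : Set where
    field
      bounded    : Bounded n s
      injective  : InjectiveBelow n s
      avoids231  : ∀ i j k → i < j → j < k → k < n →
                   s k < s i → s i < s j → ⊥
      avoids3124 : ∀ i j k l → i < j → j < k → k < l → l < n →
                   s j < s k → s k < s i → s i < s l → ⊥

  perm : Code → ℕ → ℕ
  perm single       i       = 0
  perm (under c)    zero    = size c
  perm (under c)    (suc i) = perm c i
  perm (column p c) i with i ≤? p
  ... | yes _ = p ∸ i
  ... | no  _ = suc p + perm c (i ∸ suc p)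

  perm-column-≤ : ∀ p c i → i ≤ p → perm (column p c) i ≡ p ∸ i
  perm-column-≤ p c i i≤p with i ≤? p
  ... | yes _   = refl
  ... | no  i≰p = ⊥-elim (i≰p i≤p)

  perm-column-> : ∀ p c i → p < i → perm (column p c) i ≡ suc p + perm c (i ∸ suc p)
  perm-column-> p c i p<i with i ≤? p
  ... | yes i≤p = ⊥-elim (<⇒≱ p<i i≤p)
  ... | no  _   = refl

  size-positive : ∀ c → 1 ≤ size c
  size-positive single       = s≤s z≤n
  size-positive (under c)    = s≤s z≤n
  size-positive (column p c) = s≤s z≤n

  ≤-or-> : ∀ i p → i ≤ p ⊎ p < i
  ≤-or-> i p with i ≤? p
  ... | yes i≤p = inj₁ i≤p
  ... | no  i≰p = inj₂ (≰⇒> i≰p)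

  shifted-index< : ∀ p m i → p < i → i < suc p + m → i ∸ suc p < m
  shifted-index< p m i p<i i<n =
    +-cancelˡ-< (suc p) _ _ (subst (_< suc p + m) (sym (m+[n∸m]≡n p<i)) i<n)

  perm-column-low : ∀ p c i → i ≤ p → perm (column p c) i ≤ p
  perm-column-low p c i i≤p = subst (_≤ p) (sym (perm-column-≤ p c i i≤p)) (m∸n≤m p i)

  perm-column-high : ∀ p c i → p < i → suc p ≤ perm (column p c) i
  perm-column-high p c i p<i =
    subst (suc p ≤_) (sym (perm-column-> p c i p<i)) (m≤m+n (suc p) _)

  perm-column-decreasing : ∀ p c i j → i < j → j ≤ p →
                           perm (column p c) j < perm (column p c) i
  perm-column-decreasing p c i j i<j j≤p =
    subst₂ _<_ (sym (perm-column-≤ p c j j≤p))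
               (sym (perm-column-≤ p c i (≤-trans (<⇒≤ i<j) j≤p)))
               (∸-monoʳ-< i<j j≤p)

  perm-column-high-reflects-< : ∀ p c i j → p < i → p < j →
    perm (column p c) i < perm (column p c) j → perm c (i ∸ suc p) < perm c (j ∸ suc p)
  perm-column-high-reflects-< p c i j p<i p<j lt =
    +-cancelˡ-< (suc p) _ _ (subst₂ _<_ (perm-column-> p c i p<i) (perm-column-> p c j p<j) lt)

  perm-bounded : ∀ c i → i < size c → perm c i < size c
  perm-bounded single       i       _         = s≤s z≤n
  perm-bounded (under c)    zero    _         = ≤-refl
  perm-bounded (under c)    (suc i) (s≤s i<n) = m≤n⇒m≤1+n (perm-bounded c i i<n)
  perm-bounded (column p c) i       i<n with ≤-or-> i p
  ... | inj₁ i≤p = subst (_< suc p + size c) (sym (perm-column-≤ p c i i≤p))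
                     (≤-trans (s≤s (m∸n≤m p i)) (s≤s (m≤m+n p (size c))))
  ... | inj₂ p<i = subst (_< suc p + size c) (sym (perm-column-> p c i p<i))
                     (+-monoʳ-< (suc p) (perm-bounded c (i ∸ suc p) (shifted-index< p _ i p<i i<n)))

  perm-injective : ∀ c i j → i < size c → j < size c → perm c i ≡ perm c j → i ≡ j
  perm-injective single zero    zero    _ _ _ = refl
  perm-injective single (suc i) _       (s≤s ()) _ _
  perm-injective single zero    (suc j) _ (s≤s ()) _
  perm-injective (under c) zero    zero    _ _ _ = refl
  perm-injective (under c) zero    (suc j) _ (s≤s j<n) eq = ⊥-elim (<⇒≢ (perm-bounded c j j<n) (sym eq))
  perm-injective (under c) (suc i) zero    (s≤s i<n) _ eq = ⊥-elim (<⇒≢ (perm-bounded c i i<n) eq)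
  perm-injective (under c) (suc i) (suc j) (s≤s i<n) (s≤s j<n) eq =
    cong suc (perm-injective c i j i<n j<n eq)
  perm-injective (column p c) i j i<n j<n eq with ≤-or-> i p | ≤-or-> j p
  ... | inj₁ i≤p | inj₁ j≤p =
    ∸-cancelˡ-≡ i≤p j≤p (trans (sym (perm-column-≤ p c i i≤p)) (trans eq (perm-column-≤ p c j j≤p)))
  ... | inj₁ i≤p | inj₂ p<j =
    ⊥-elim (<⇒≢ (≤-<-trans (perm-column-low p c i i≤p) (perm-column-high p c j p<j)) eq)
  ... | inj₂ p<i | inj₁ j≤p =
    ⊥-elim (<⇒≢ (≤-<-trans (perm-column-low p c j j≤p) (perm-column-high p c i p<i)) (sym eq))
  ... | inj₂ p<i | inj₂ p<j =
    ∸-cancelʳ-≡ p<i p<j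
      (perm-injective c (i ∸ suc p) (j ∸ suc p)
        (shifted-index< p _ i p<i i<n) (shifted-index< p _ j p<j j<n)
        (+-cancelˡ-≡ (suc p) _ _
          (trans (sym (perm-column-> p c i p<i)) (trans eq (perm-column-> p c j p<j)))))

  perm-avoids231 : ∀ c i j k → i < j → j < k → k < size c →
                   perm c k < perm c i → perm c i < perm c j → ⊥
  perm-avoids231 single i j zero i<j () _ _ _
  perm-avoids231 single i j (suc k) i<j j<k (s≤s ()) _ _
  perm-avoids231 (under c) zero (suc j) (suc k) _ (s≤s j<k) (s≤s k<n) _ i<j′ =
    <⇒≱ (perm-bounded c j (<-trans j<k k<n)) (<⇒≤ i<j′)
  perm-avoids231 (under c) (suc i) (suc j) (suc k) (s≤s i<j) (s≤s j<k) (s≤s k<n) =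
    perm-avoids231 c i j k i<j j<k k<n
  perm-avoids231 (column p c) i j k i<j j<k k<n k<i i<j′ with ≤-or-> j p
  ... | inj₁ j≤p = <-asym i<j′ (perm-column-decreasing p c i j i<j j≤p)
  ... | inj₂ p<j with ≤-or-> i p
  ...   | inj₁ i≤p =
    <⇒≱ k<i (≤-trans (perm-column-low p c i i≤p) (<⇒≤ (perm-column-high p c k (<-trans p<j j<k))))
  ...   | inj₂ p<i =
    let p<k = <-trans p<j j<k in
    perm-avoids231 c (i ∸ suc p) (j ∸ suc p) (k ∸ suc p)
      (∸-monoˡ-< i<j p<i) (∸-monoˡ-< j<k p<j) (shifted-index< p _ k p<k k<n)
      (perm-column-high-reflects-< p c k i p<k p<i k<i)
      (perm-column-high-reflects-< p c i j p<i p<j i<j′)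

  perm-avoids3124 : ∀ c i j k l → i < j → j < k → k < l → l < size c →
                    perm c j < perm c k → perm c k < perm c i → perm c i < perm c l → ⊥
  perm-avoids3124 single i j k zero _ _ () _ _ _ _
  perm-avoids3124 single i j k (suc l) _ _ _ (s≤s ()) _ _ _
  perm-avoids3124 (under c) zero (suc j) (suc k) (suc l) _ _ _ (s≤s l<n) _ _ i<l =
    <⇒≱ (perm-bounded c l l<n) (<⇒≤ i<l)
  perm-avoids3124 (under c) (suc i) (suc j) (suc k) (suc l)
    (s≤s i<j) (s≤s j<k) (s≤s k<l) (s≤s l<n) =
    perm-avoids3124 c i j k l i<j j<k k<l l<n
  perm-avoids3124 (column p c) i j k l i<j j<k k<l l<n j<k′ k<i i<l with ≤-or-> k p
  ... | inj₁ k≤p = <-asym j<k′ (perm-column-decreasing p c j k j<k k≤p)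
  ... | inj₂ p<k with ≤-or-> i p
  ...   | inj₁ i≤p = <⇒≱ k<i (≤-trans (perm-column-low p c i i≤p) (<⇒≤ (perm-column-high p c k p<k)))
  ...   | inj₂ p<i =
    let p<j = <-trans p<i i<j ; p<l = <-trans p<k k<l in
    perm-avoids3124 c (i ∸ suc p) (j ∸ suc p) (k ∸ suc p) (l ∸ suc p)
      (∸-monoˡ-< i<j p<i) (∸-monoˡ-< j<k p<j) (∸-monoˡ-< k<l p<k) (shifted-index< p _ l p<l l<n)
      (perm-column-high-reflects-< p c j k p<j p<k j<k′)
      (perm-column-high-reflects-< p c k i p<k p<i k<i)
      (perm-column-high-reflects-< p c i l p<i p<l i<l)

  perm-IsS231-3124 : ∀ c → IsS231-3124 (size c) (perm c)
  perm-IsS231-3124 c = record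
    { bounded    = perm-bounded c
    ; injective  = perm-injective c
    ; avoids231  = perm-avoids231 c
    ; avoids3124 = perm-avoids3124 c
    }

  perm-column-shift : ∀ p c i → perm (column p c) (suc p + i) ≡ suc p + perm c i
  perm-column-shift p c i =
    trans (perm-column-> p c (suc p + i) (s≤s (m≤m+n p i)))
          (cong (λ k → suc p + perm c k) (m+n∸m≡n (suc p) i))

  perm-column-first<max : ∀ p c → p < size (column p c) ∸ 1
  perm-column-first<max p c = m<m+n p (size-positive c)

  perm-determines-code : ∀ c c′ → size c ≡ size c′ →
                         (∀ i → i < size c → perm c i ≡ perm c′ i) → c ≡ c′
  perm-determines-code single single _ _ = refl
  perm-determines-code single (under c′) eq _ = ⊥-elim (<-irrefl (suc-injective eq) (size-positive c′))
  perm-determines-code single (column q c′) eq _ =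
    ⊥-elim (<-irrefl (suc-injective eq) (≤-trans (size-positive c′) (m≤n+m _ q)))
  perm-determines-code (under c) single eq _ = ⊥-elim (<-irrefl (sym (suc-injective eq)) (size-positive c))
  perm-determines-code (column p c) single eq _ =
    ⊥-elim (<-irrefl (sym (suc-injective eq)) (≤-trans (size-positive c) (m≤n+m _ p)))
  perm-determines-code (under c) (under c′) eq agree =
    cong under (perm-determines-code c c′ (suc-injective eq) (λ i i<n → agree (suc i) (s≤s i<n)))
  perm-determines-code (under c) (column q c′) eq agree =
    ⊥-elim (<-irrefl (trans (sym (perm-column-≤ q c′ 0 z≤n)) (sym (agree 0 (s≤s z≤n))))
                     (subst (q <_) (sym (suc-injective eq)) (perm-column-first<max q c′)))
  perm-determines-code (column p c) (under c′) eq agree =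
    ⊥-elim (<-irrefl (trans (sym (perm-column-≤ p c 0 z≤n)) (agree 0 (s≤s z≤n)))
                     (subst (p <_) (suc-injective eq) (perm-column-first<max p c)))
  perm-determines-code (column p c) (column q c′) eq agree
    with trans (sym (perm-column-≤ p c 0 z≤n)) (trans (agree 0 (s≤s z≤n)) (perm-column-≤ q c′ 0 z≤n))
  ... | refl = cong (column p) (perm-determines-code c c′ (+-cancelˡ-≡ (suc p) _ _ eq) agree-tail)
    where
    agree-tail : ∀ i → i < size c → perm c i ≡ perm c′ i
    agree-tail i i<n = +-cancelˡ-≡ (suc p) _ _ (begin
      suc p + perm c i           ≡⟨ perm-column-shift p c i ⟨
      perm (column p c) (suc p + i)  ≡⟨ agree (suc p + i) (+-monoʳ-< (suc p) i<n) ⟩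
      perm (column p c′) (suc p + i) ≡⟨ perm-column-shift p c′ i ⟩
      suc p + perm c′ i          ∎)
      where open ≡-Reasoning


module DecodingPermutations where
  open Codes
  open PermutationsOfCodes
  open import Data.Nat
  open import Data.Nat.Properties
  open import Data.Nat.Induction using (<-wellFounded)
  open import Induction.WellFounded using (Acc; acc)
  open import Data.Product using (Σ; ∃; _×_; _,_; proj₁; proj₂)
  open import Data.Sum using (inj₁; inj₂)
  open import Data.Empty using (⊥; ⊥-elim)
  open import Relation.Nullary using (yes; no)
  open import Relation.Binary.PropositionalEquality
  open import Relation.Binary.Definitions using (tri<; tri≈; tri>)

  _[_≔_] : (ℕ → ℕ) → ℕ → ℕ → ℕ → ℕ
  (s [ k ≔ w ]) i with i ≟ k
  ... | yes _ = w
  ... | no  _ = s i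

  module _ (m : ℕ) (s : ℕ → ℕ) (bnd : Bounded (suc m) s) (inj : InjectiveBelow (suc m) s)
           (i₀ : ℕ) (i₀<n : i₀ < suc m) (sᵢ₀≡m : s i₀ ≡ m) where

    private
      s≢m : ∀ i → i < suc m → i ≢ i₀ → s i ≢ m
      s≢m i i<n i≢i₀ si≡m = i≢i₀ (inj i i₀ i<n i₀<n (trans si≡m (sym sᵢ₀≡m)))

      sm≢si : ∀ i → i < m → s m ≢ s i
      sm≢si i i<m eq = <⇒≢ i<m (sym (inj m i ≤-refl (m≤n⇒m≤1+n i<m) eq))

    bounded-without-maximum : Bounded m (s [ i₀ ≔ s m ])
    bounded-without-maximum i i<m with i ≟ i₀
    ... | yes refl = ≤∧≢⇒< (s≤s⁻¹ (bnd m ≤-refl)) (s≢m m ≤-refl (λ m≡i → <⇒≢ i<m (sym m≡i)))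
    ... | no  i≢i₀ = ≤∧≢⇒< (s≤s⁻¹ (bnd i (m≤n⇒m≤1+n i<m))) (s≢m i (m≤n⇒m≤1+n i<m) i≢i₀)

    injective-without-maximum : InjectiveBelow m (s [ i₀ ≔ s m ])
    injective-without-maximum i j i<m j<m eq with i ≟ i₀ | j ≟ i₀
    ... | yes i≡i₀ | yes j≡i₀ = trans i≡i₀ (sym j≡i₀)
    ... | yes _    | no  _    = ⊥-elim (sm≢si j j<m eq)
    ... | no  _    | yes _    = ⊥-elim (sm≢si i i<m (sym eq))
    ... | no  _    | no  _    = inj i j (m≤n⇒m≤1+n i<m) (m≤n⇒m≤1+n j<m) eq

  mutual
    bounded-injective⇒surjective : ∀ n s → Bounded n s → InjectiveBelow n s →
                                   ∀ v → v < n → ∃ λ i → i < n × s i ≡ v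
    bounded-injective⇒surjective zero s _ _ v ()
    bounded-injective⇒surjective (suc m) s bnd inj v v<n
      with bounded-injective⇒maximum-attained m s bnd inj
    ... | i₀ , i₀<n , sᵢ₀≡m with v ≟ m
    ...   | yes refl = i₀ , i₀<n , sᵢ₀≡m
    ...   | no  v≢m
      with bounded-injective⇒surjective m (s [ i₀ ≔ s m ])
             (bounded-without-maximum m s bnd inj i₀ i₀<n sᵢ₀≡m)
             (injective-without-maximum m s bnd inj i₀ i₀<n sᵢ₀≡m)
             v (≤∧≢⇒< (s≤s⁻¹ v<n) v≢m)
    ...     | i , i<m , eq with i ≟ i₀
    ...       | yes _ = m , ≤-refl , eq
    ...       | no  _ = i , m≤n⇒m≤1+n i<m , eq

    bounded-injective⇒maximum-attained : ∀ m s → Bounded (suc m) s → InjectiveBelow (suc m) s →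
                                        ∃ λ i → i < suc m × s i ≡ m
    bounded-injective⇒maximum-attained m s bnd inj with anyUpTo? (λ i → s i ≟ m) (suc m)
    ... | yes attained = attained
    ... | no  missed
      with bounded-injective⇒surjective m s
             (λ i i<m → below-m i (m≤n⇒m≤1+n i<m))
             (λ i j i<m j<m → inj i j (m≤n⇒m≤1+n i<m) (m≤n⇒m≤1+n j<m))
             (s m) (below-m m ≤-refl)
      where
      below-m : ∀ i → i < suc m → s i < m
      below-m i i<n = ≤∧≢⇒< (s≤s⁻¹ (bnd i i<n)) (λ si≡m → missed (i , i<n , si≡m))
    ...   | i , i<m , si≡sm = ⊥-elim (<⇒≢ i<m (inj i m (m≤n⇒m≤1+n i<m) ≤-refl si≡sm))

  module _ {n : ℕ} {s : ℕ → ℕ} (S : IsS231-3124 n s) {a : ℕ} (a≤n : a ≤ n) (b : ℕ)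
           (b≤ : ∀ i → i < n ∸ a → b ≤ s (a + i))
           (bnd : Bounded (n ∸ a) (λ i → s (a + i) ∸ b)) where
    open IsS231-3124 S

    private
      t : ℕ → ℕ
      t i = s (a + i) ∸ b

      shift< : ∀ {i} → i < n ∸ a → a + i < n
      shift< {i} i<n∸a =
        subst (_≤ n) (trans (+-comm (suc i) a) (+-suc a i)) (m≤o∸n⇒m+n≤o (suc i) a≤n i<n∸a)

      t+b≡s : ∀ i → i < n ∸ a → t i + b ≡ s (a + i)
      t+b≡s i i<n∸a = m∸n+n≡m (b≤ i i<n∸a)

      t<⇒s< : ∀ {i j} → i < n ∸ a → j < n ∸ a → t i < t j → s (a + i) < s (a + j)
      t<⇒s< {i} {j} i< j< lt = subst₂ _<_ (t+b≡s i i<) (t+b≡s j j<) (+-monoˡ-< b lt)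

      a+ : ∀ {i j} → i < j → a + i < a + j
      a+ = +-monoʳ-< a

    restriction-IsS231-3124 : IsS231-3124 (n ∸ a) t
    restriction-IsS231-3124 = record
      { bounded    = bnd
      ; injective  = λ i j i< j< eq → +-cancelˡ-≡ a _ _
          (injective (a + i) (a + j) (shift< i<) (shift< j<)
            (trans (sym (t+b≡s i i<)) (trans (cong (_+ b) eq) (t+b≡s j j<))))
      ; avoids231  = λ i j k i<j j<k k< k<i i<j′ →
          let j< = <-trans j<k k< ; i< = <-trans i<j j< in
          avoids231 (a + i) (a + j) (a + k) (a+ i<j) (a+ j<k) (shift< k<)
            (t<⇒s< k< i< k<i) (t<⇒s< i< j< i<j′)
      ; avoids3124 = λ i j k l i<j j<k k<l l< x y z →
          let k< = <-trans k<l l< ; j< = <-trans j<k k< ; i< = <-trans i<j j< in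
          avoids3124 (a + i) (a + j) (a + k) (a + l) (a+ i<j) (a+ j<k) (a+ k<l) (shift< l<)
            (t<⇒s< j< k< x) (t<⇒s< k< i< y) (t<⇒s< i< l< z)
      }

  module _ {m : ℕ} {s : ℕ → ℕ} (S : IsS231-3124 (suc (suc m)) s) (v<max : s 0 < suc m) where
    open IsS231-3124 S

    private
      n = suc (suc m)
      v = s 0

      v<n : v < n
      v<n = m≤n⇒m≤1+n v<max

      maximum = bounded-injective⇒maximum-attained (suc m) s bounded injective
      L = proj₁ maximum
      L<n = proj₁ (proj₂ maximum)
      sL≡max = proj₂ (proj₂ maximum)

      v<sL : v < s L
      v<sL = subst (v <_) (sym sL≡max) v<max

      small-before-maximum : ∀ k → k < n → s k < v → k < L
      small-before-maximum k k<n sk<v with <-cmp k L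
      ... | tri< k<L _ _ = k<L
      ... | tri≈ _ refl _ = ⊥-elim (<-asym sk<v v<sL)
      ... | tri> _ _ L<k = ⊥-elim (avoids231 0 L k 0<L L<k k<n sk<v v<sL)
        where
        0<L : 0 < L
        0<L = n≢0⇒n>0 (λ L≡0 → <-irrefl (sym (cong s L≡0)) v<sL)

      v∸suc<v : ∀ {i} → suc i ≤ v → v ∸ suc i < v
      v∸suc<v i≤v = ∸-monoʳ-< (s≤s z≤n) i≤v

      preimage-not-after : ∀ i′ → suc i′ ≤ v → (∀ j → j ≤ i′ → s j ≡ v ∸ j) →
                           ∀ q → suc i′ < q → q < n → s q ≡ v ∸ suc i′ → ⊥
      preimage-not-after i′ i≤v prefix q i<q q<n sq≡u with <-cmp (s (suc i′)) v
      ... | tri≈ _ si≡v _ = 1+n≢0 (injective (suc i′) 0 (<-trans i<q q<n) (s≤s z≤n) si≡v)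
      ... | tri> _ _ v<si = avoids231 0 (suc i′) q (s≤s z≤n) i<q q<n sq<v v<si
        where
        sq<v : s q < v
        sq<v = subst (_< v) (sym sq≡u) (v∸suc<v i≤v)
      ... | tri< si<v _ _ with <-cmp (s (suc i′)) (v ∸ suc i′)
      ...   | tri≈ _ si≡u _ = <-irrefl (injective (suc i′) q (<-trans i<q q<n) q<n (trans si≡u (sym sq≡u))) i<q
      ...   | tri> _ _ u<si = <-irrefl (injective j (suc i′) j<n (<-trans i<q q<n) sj≡si) (s≤s j≤i′)
        where
        j = v ∸ s (suc i′)
        j≤i′ : j ≤ i′
        j≤i′ = s≤s⁻¹ (m<n+o⇒m∸n<o v (s (suc i′))
                 (subst (_< s (suc i′) + suc i′) (m∸n+n≡m i≤v) (+-monoˡ-< (suc i′) u<si)))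
        j<n : j < n
        j<n = ≤-<-trans (m∸n≤m v (s (suc i′))) v<n
        sj≡si : s j ≡ s (suc i′)
        sj≡si = trans (prefix j j≤i′) (m∸[m∸n]≡n (<⇒≤ si<v))
      ...   | tri< si<u _ _ =
        avoids3124 0 (suc i′) q L (s≤s z≤n) i<q (small-before-maximum q q<n sq<v) L<n
          (subst (s (suc i′) <_) (sym sq≡u) si<u) sq<v v<sL
        where
        sq<v : s q < v
        sq<v = subst (_< v) (sym sq≡u) (v∸suc<v i≤v)

      -- The preimage q of v ∸ i cannot precede i, where v, …, v ∸ (i − 1)
      -- are placed.  If it followed i, an entry at i above v would give a
      -- 231 at positions 0, i, q, one below v ∸ i a 3124 at 0, i, q and the
      -- maximum, and the values in between are already taken.
      descending-step : ∀ i′ → suc i′ ≤ v → (∀ j → j ≤ i′ → s j ≡ v ∸ j) →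
                        s (suc i′) ≡ v ∸ suc i′
      descending-step i′ i≤v prefix
        with bounded-injective⇒surjective n s bounded injective (v ∸ suc i′) (<-trans (v∸suc<v i≤v) v<n)
      ... | q , q<n , sq≡u with <-cmp q (suc i′)
      ...   | tri≈ _ refl _ = sq≡u
      ...   | tri< q<i _ _ =
        ⊥-elim (<-irrefl (∸-cancelˡ-≡ (≤-trans (<⇒≤ q<i) i≤v) i≤v
                           (trans (sym (prefix q (s≤s⁻¹ q<i))) sq≡u)) q<i)
      ...   | tri> _ _ i<q = ⊥-elim (preimage-not-after i′ i≤v prefix q i<q q<n sq≡u)


    first-descending : ∀ i → i ≤ s 0 → s i ≡ s 0 ∸ i
    first-descending i i≤v = descending-upto i i≤v i ≤-refl
      where
      descending-upto : ∀ i → i ≤ v → ∀ j → j ≤ i → s j ≡ v ∸ j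
      descending-upto zero     _   zero _   = refl
      descending-upto (suc i′) i≤v j    j≤i with m≤n⇒m<n∨m≡n j≤i
      ... | inj₁ j<i  = descending-upto i′ (m+n≤o⇒n≤o 1 i≤v) j (s≤s⁻¹ j<i)
      ... | inj₂ refl = descending-step i′ i≤v (descending-upto i′ (m+n≤o⇒n≤o 1 i≤v))

    first-descending-rest-above : ∀ i → s 0 < i → i < suc (suc m) → s 0 < s i
    first-descending-rest-above i v<i i<n with s i ≤? v
    ... | no  si≰v = ≰⇒> si≰v
    ... | yes si≤v = ⊥-elim (<-irrefl (injective j i (≤-<-trans j≤v v<n) i<n sj≡si) (≤-<-trans j≤v v<i))
      where
      j = v ∸ s i
      j≤v : j ≤ v
      j≤v = m∸n≤m v (s i)
      sj≡si : s j ≡ s i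
      sj≡si = trans (first-descending j j≤v) (m∸[m∸n]≡n si≤v)

  Decoding : ℕ → (ℕ → ℕ) → Set
  Decoding n s = Σ Code λ c → size c ≡ n × (∀ i → i < n → perm c i ≡ s i)

  under-decoding : ∀ {m s} → s 0 ≡ suc m → Decoding (suc m) (λ i → s (suc i)) →
                   Decoding (suc (suc m)) s
  under-decoding s0≡max (c , size≡ , agree) =
    under c , cong suc size≡ ,
    λ { zero _ → trans size≡ (sym s0≡max) ; (suc i) (s≤s i<n) → agree i i<n }

  column-decoding : ∀ {n s} v → suc v ≤ n →
                    (∀ i → i ≤ v → s i ≡ v ∸ i) → (∀ i → v < i → i < n → suc v ≤ s i) →
                    Decoding (n ∸ suc v) (λ i → s (suc v + i) ∸ suc v) → Decoding n s
  column-decoding {n} {s} v v<n descending rest-above (c , size≡ , agree) =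
    column v c , trans (cong (suc v +_) size≡) (m+[n∸m]≡n v<n) , agree′
    where
    agree′ : ∀ i → i < n → perm (column v c) i ≡ s i
    agree′ i i<n with ≤-or-> i v
    ... | inj₁ i≤v = trans (perm-column-≤ v c i i≤v) (sym (descending i i≤v))
    ... | inj₂ v<i = begin
      perm (column v c) i                   ≡⟨ perm-column-> v c i v<i ⟩
      suc v + perm c (i ∸ suc v)            ≡⟨ cong (suc v +_) (agree (i ∸ suc v) (∸-monoˡ-< i<n v<i)) ⟩
      suc v + (s (suc v + (i ∸ suc v)) ∸ suc v) ≡⟨ cong (λ k → suc v + (s k ∸ suc v)) (m+[n∸m]≡n v<i) ⟩
      suc v + (s i ∸ suc v)                 ≡⟨ m+[n∸m]≡n (rest-above i v<i i<n) ⟩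
      s i                                   ∎
      where open ≡-Reasoning

  decode-acc : ∀ n s → 1 ≤ n → IsS231-3124 n s → Acc _<_ n → Decoding n s
  decode-acc (suc zero) s _ S _ =
    single , refl , λ { zero _ → sym (n<1⇒n≡0 (bounded 0 (s≤s z≤n))) ; (suc i) (s≤s ()) }
    where open IsS231-3124 S
  decode-acc (suc (suc m)) s _ S (acc rec) with s 0 ≟ suc m
  ... | yes s0≡max =
    under-decoding s0≡max
      (decode-acc (suc m) (λ i → s (suc i)) (s≤s z≤n)
        (restriction-IsS231-3124 S (s≤s z≤n) 0 (λ _ _ → z≤n) bounded-tail) (rec ≤-refl))
    where
    open IsS231-3124 S
    bounded-tail : Bounded (suc m) (λ i → s (suc i))
    bounded-tail i i<m = ≤∧≢⇒< (s≤s⁻¹ (bounded (suc i) (s≤s i<m)))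
      (λ eq → 1+n≢0 (injective (suc i) 0 (s≤s i<m) (s≤s z≤n) (trans eq (sym s0≡max))))
  ... | no s0≢max =
    column-decoding v (<⇒≤ v+1<n) (first-descending S v<max) (first-descending-rest-above S v<max)
      (decode-acc (n ∸ suc v) _ (m<n⇒0<n∸m v+1<n)
        (restriction-IsS231-3124 S (<⇒≤ v+1<n) (suc v) rest-above bounded-rest)
        (rec (s≤s (m∸n≤m (suc m) v))))
    where
    open IsS231-3124 S
    n = suc (suc m)
    v = s 0
    v<max : v < suc m
    v<max = ≤∧≢⇒< (s≤s⁻¹ (bounded 0 (s≤s z≤n))) s0≢max
    v+1<n : suc v < n
    v+1<n = s≤s v<max
    shift< : ∀ i → i < n ∸ suc v → suc v + i < n
    shift< i i< = subst (suc v + i <_) (m+[n∸m]≡n (<⇒≤ v+1<n)) (+-monoʳ-< (suc v) i<)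
    rest-above : ∀ i → i < n ∸ suc v → suc v ≤ s (suc v + i)
    rest-above i i< = first-descending-rest-above S v<max (suc v + i) (s≤s (m≤m+n v i)) (shift< i i<)
    bounded-rest : Bounded (n ∸ suc v) (λ i → s (suc v + i) ∸ suc v)
    bounded-rest i i< = ∸-monoˡ-< (bounded (suc v + i) (shift< i i<)) (rest-above i i<)

  decode : ∀ n s → 1 ≤ n → IsS231-3124 n s → Decoding n s
  decode n s 1≤n S = decode-acc n s 1≤n S (<-wellFounded n)


module PermutationVectors where
  open PermutationsOfCodes using (Bounded; IsS231-3124)
  open import Data.Nat
  open import Data.Nat.Properties
  open import Data.Fin as Fin using (Fin; toℕ; fromℕ<)
  open import Data.Fin.Properties using (toℕ-injective; toℕ<n; toℕ-fromℕ<; fromℕ<-toℕ)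
  open import Data.Vec using (Vec; tabulate; lookup)
  open import Data.Vec.Properties using (lookup∘tabulate; tabulate∘lookup; tabulate-cong)
  open import Data.Product using (_,_)
  open import Data.Empty using (⊥-elim)
  open import Relation.Nullary using (¬_; yes; no)
  open import Relation.Binary.PropositionalEquality

  -- Out-of-range values, which bounded functions never produce, are
  -- replaced by the position itself.
  toFin : ∀ {n} → ℕ → Fin n → Fin n
  toFin {n} v i with v <? n
  ... | yes v<n = fromℕ< v<n
  ... | no  _   = i

  toℕ-toFin : ∀ {n} v (i : Fin n) → v < n → toℕ (toFin v i) ≡ v
  toℕ-toFin {n} v i v<n with v <? n
  ... | yes _   = toℕ-fromℕ< _
  ... | no  v≮n = ⊥-elim (v≮n v<n)

  vector : (n : ℕ) → (ℕ → ℕ) → Vec (Fin n) n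
  vector n s = tabulate (λ i → toFin (s (toℕ i)) i)

  lookup-vector : ∀ {n s} → Bounded n s → ∀ i → toℕ (lookup (vector n s) i) ≡ s (toℕ i)
  lookup-vector {s = s} bnd i =
    trans (cong toℕ (lookup∘tabulate _ i)) (toℕ-toFin (s (toℕ i)) i (bnd (toℕ i) (toℕ<n i)))

  vector-cong : ∀ {n s s′} → (∀ i → i < n → s i ≡ s′ i) → vector n s ≡ vector n s′
  vector-cong agree = tabulate-cong (λ i → cong (λ v → toFin v i) (agree (toℕ i) (toℕ<n i)))

  vector-injective : ∀ {n s s′} → Bounded n s → Bounded n s′ → vector n s ≡ vector n s′ →
                     ∀ i → i < n → s i ≡ s′ i
  vector-injective {n} {s} {s′} bnd bnd′ eq i i<n = begin
    s i                               ≡⟨ cong s (toℕ-fromℕ< i<n) ⟨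
    s (toℕ k)                         ≡⟨ lookup-vector bnd k ⟨
    toℕ (lookup (vector n s) k)       ≡⟨ cong (λ σ → toℕ (lookup σ k)) eq ⟩
    toℕ (lookup (vector n s′) k)      ≡⟨ lookup-vector bnd′ k ⟩
    s′ (toℕ k)                        ≡⟨ cong s′ (toℕ-fromℕ< i<n) ⟩
    s′ i                              ∎
    where
    open ≡-Reasoning
    k = fromℕ< i<n

  vector-InS231-3124 : ∀ {n s} → IsS231-3124 n s → InS231-3124 (vector n s)
  vector-InS231-3124 {n} {s} S = isPermutation , no231 , no3124
    where
    open IsS231-3124 S
    L = lookup-vector bounded
    <-values : ∀ {i j} → lookup (vector n s) i Fin.< lookup (vector n s) j → s (toℕ i) < s (toℕ j)
    <-values {i} {j} = subst₂ _<_ (L i) (L j)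
    isPermutation : IsPermutation (vector n s)
    isPermutation {i} {j} eq = toℕ-injective (injective (toℕ i) (toℕ j) (toℕ<n i) (toℕ<n j)
      (trans (sym (L i)) (trans (cong toℕ eq) (L j))))
    no231 : ¬ Contains231 (vector n s)
    no231 (i , j , k , i<j , j<k , x , y) =
      avoids231 (toℕ i) (toℕ j) (toℕ k) i<j j<k (toℕ<n k) (<-values x) (<-values y)
    no3124 : ¬ Contains3124 (vector n s)
    no3124 (i , j , k , l , i<j , j<k , k<l , x , y , z) =
      avoids3124 (toℕ i) (toℕ j) (toℕ k) (toℕ l) i<j j<k k<l (toℕ<n l)
        (<-values x) (<-values y) (<-values z)

  valueAt : ∀ {n} → Vec (Fin n) n → ℕ → ℕ
  valueAt {n} σ i with i <? n
  ... | yes i<n = toℕ (lookup σ (fromℕ< i<n))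
  ... | no  _   = 0

  valueAt-toℕ : ∀ {n} (σ : Vec (Fin n) n) k → valueAt σ (toℕ k) ≡ toℕ (lookup σ k)
  valueAt-toℕ {n} σ k with toℕ k <? n
  ... | yes k<n = cong (λ k′ → toℕ (lookup σ k′)) (fromℕ<-toℕ k k<n)
  ... | no  k≮n = ⊥-elim (k≮n (toℕ<n k))

  valueAt-fromℕ< : ∀ {n} (σ : Vec (Fin n) n) {i} (i<n : i < n) →
                   valueAt σ i ≡ toℕ (lookup σ (fromℕ< i<n))
  valueAt-fromℕ< σ i<n = trans (cong (valueAt σ) (sym (toℕ-fromℕ< i<n))) (valueAt-toℕ σ (fromℕ< i<n))

  vector-valueAt : ∀ {n} (σ : Vec (Fin n) n) → vector n (valueAt σ) ≡ σ
  vector-valueAt σ = trans (tabulate-cong entry) (tabulate∘lookup σ)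
    where
    entry : ∀ k → toFin (valueAt σ (toℕ k)) k ≡ lookup σ k
    entry k = toℕ-injective (trans (toℕ-toFin _ k (subst (_< _) (sym (valueAt-toℕ σ k)) (toℕ<n _)))
                                   (valueAt-toℕ σ k))

  valueAt-IsS231-3124 : ∀ {n} (σ : Vec (Fin n) n) → InS231-3124 σ → IsS231-3124 n (valueAt σ)
  valueAt-IsS231-3124 {n} σ (isPermutation , no231 , no3124) = record
    { bounded    = λ i i<n → subst (_< n) (sym (V i<n)) (toℕ<n _)
    ; injective  = λ i j i<n j<n eq →
        trans (sym (toℕ-fromℕ< i<n)) (trans (cong toℕ (isPermutation (toℕ-injective
          (trans (sym (V i<n)) (trans eq (V j<n)))))) (toℕ-fromℕ< j<n))
    ; avoids231  = λ i j k i<j j<k k<n x y →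
        let j<n = <-trans j<k k<n ; i<n = <-trans i<j j<n in
        no231 (fromℕ< i<n , fromℕ< j<n , fromℕ< k<n , position i<n j<n i<j , position j<n k<n j<k ,
               value k<n i<n x , value i<n j<n y)
    ; avoids3124 = λ i j k l i<j j<k k<l l<n x y z →
        let k<n = <-trans k<l l<n ; j<n = <-trans j<k k<n ; i<n = <-trans i<j j<n in
        no3124 (fromℕ< i<n , fromℕ< j<n , fromℕ< k<n , fromℕ< l<n ,
                position i<n j<n i<j , position j<n k<n j<k , position k<n l<n k<l ,
                value j<n k<n x , value k<n i<n y , value i<n l<n z)
    }
    where
    V = valueAt-fromℕ< σ
    position : ∀ {i j} (i<n : i < n) (j<n : j < n) → i < j → fromℕ< i<n Fin.< fromℕ< j<n
    position i<n j<n = subst₂ _<_ (sym (toℕ-fromℕ< i<n)) (sym (toℕ-fromℕ< j<n))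
    value : ∀ {i j} (i<n : i < n) (j<n : j < n) → valueAt σ i < valueAt σ j →
            lookup σ (fromℕ< i<n) Fin.< lookup σ (fromℕ< j<n)
    value i<n j<n = subst₂ _<_ (V i<n) (V j<n)


module CellGeometry where
  open import Data.Nat as ℕ using (s≤s; z≤n)
  import Data.Nat.Properties as ℕP
  open import Data.Integer as ℤ using (-_; 0ℤ; 1ℤ; _+_; _-_)
  import Data.Integer.Properties as ℤP
  open import Data.Integer.Tactic.RingSolver using (solve-∀)
  open import Data.List using (List; []; _∷_; filter; length)
  open import Data.List.Membership.Propositional using (_∈_)
  open import Data.List.Membership.Propositional.Properties using (∈-filter⁺)
  open import Data.List.Relation.Unary.Any using (here; there)
  import Data.List.Relation.Unary.Any as Any
  import Data.List.Relation.Unary.All as All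
  open import Data.List.Relation.Unary.AllPairs using (_∷_)
  open import Data.List.Relation.Unary.Unique.Propositional using (Unique)
  open import Data.List.Relation.Binary.Subset.Propositional using (_⊆_)
  open import Data.List.Properties using (filter-notAll)
  open import Data.Product using (_×_; _,_; proj₁; proj₂)
  open import Data.Product.Properties using (≡-dec)
  open import Relation.Nullary using (¬?)
  open import Relation.Binary.PropositionalEquality
  open import Relation.Binary.Definitions using (DecidableEquality)
  open import Function.Bundles using (mk⇔; Equivalence)

  _≟ᶜ_ : DecidableEquality Cell
  _≟ᶜ_ = ≡-dec ℤ._≟_ ℤ._≟_

  origin : Cell
  origin = 0ℤ , 0ℤ

  _+ᶜ_ : Cell → Cell → Cell
  (x , y) +ᶜ (a , b) = x + a , y + b

  _-ᶜ_ : Cell → Cell → Cell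
  (x , y) -ᶜ (a , b) = x - a , y - b

  +ᶜ-ᶜ : ∀ z s → (z +ᶜ s) -ᶜ s ≡ z
  +ᶜ-ᶜ (x , y) (a , b) = cong₂ _,_ (law x a) (law y b)
    where
    law : ∀ x a → x + a - a ≡ x
    law = solve-∀

  -ᶜ+ᶜ : ∀ z s → (z -ᶜ s) +ᶜ s ≡ z
  -ᶜ+ᶜ (x , y) (a , b) = cong₂ _,_ (law x a) (law y b)
    where
    law : ∀ x a → x - a + a ≡ x
    law = solve-∀

  -ᶜ-cancelʳ : ∀ s {z w} → z -ᶜ s ≡ w -ᶜ s → z ≡ w
  -ᶜ-cancelʳ s {z} {w} eq = trans (sym (-ᶜ+ᶜ z s)) (trans (cong (_+ᶜ s) eq) (-ᶜ+ᶜ w s))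

  +ᶜ-cancelʳ : ∀ s {z w} → z +ᶜ s ≡ w +ᶜ s → z ≡ w
  +ᶜ-cancelʳ s {z} {w} eq = trans (sym (+ᶜ-ᶜ z s)) (trans (cong (_-ᶜ s) eq) (+ᶜ-ᶜ w s))

  -ᶜ-self : ∀ s → s -ᶜ s ≡ origin
  -ᶜ-self (a , b) = cong₂ _,_ (ℤP.+-inverseʳ a) (ℤP.+-inverseʳ b)

  -ᶜ≡origin⇒≡ : ∀ {z} s → z -ᶜ s ≡ origin → z ≡ s
  -ᶜ≡origin⇒≡ s eq = -ᶜ-cancelʳ s (trans eq (sym (-ᶜ-self s)))

  +-cancelʳ : ∀ c {a b} → a + c ≡ b + c → a ≡ b
  +-cancelʳ c {a} {b} eq = trans (sym (law a c)) (trans (cong (_- c) eq) (law b c))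
    where
    law : ∀ a c → a + c - c ≡ a
    law = solve-∀

  +-cancelˡ : ∀ c {a b} → c + a ≡ c + b → a ≡ b
  +-cancelˡ c {a} {b} eq = +-cancelʳ c (trans (ℤP.+-comm a c) (trans eq (ℤP.+-comm c b)))

  above-injective : ∀ {z w} → above z ≡ above w → z ≡ w
  above-injective {_ , _} {_ , _} eq =
    cong₂ _,_ (cong proj₁ eq) (+-cancelʳ 1ℤ (cong proj₂ eq))

  right-injective : ∀ {z w} → right z ≡ right w → z ≡ w
  right-injective {_ , _} {_ , _} eq =
    cong₂ _,_ (+-cancelʳ 1ℤ (cong proj₁ eq)) (cong proj₂ eq)

  above-ᶜ : ∀ z s → above (z -ᶜ above s) ≡ z -ᶜ s
  above-ᶜ (x , y) (a , b) = cong (x - a ,_) (law y b)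
    where
    law : ∀ y b → y - (b + 1ℤ) + 1ℤ ≡ y - b
    law = solve-∀

  right-ᶜ : ∀ z s → right (z -ᶜ right s) ≡ z -ᶜ s
  right-ᶜ (x , y) (a , b) = cong (_, y - b) (law x a)
    where
    law : ∀ x a → x - (a + 1ℤ) + 1ℤ ≡ x - a
    law = solve-∀

  i<i+1 : ∀ i → i ℤ.< i + 1ℤ
  i<i+1 i = subst (ℤ._< i + 1ℤ) (ℤP.+-identityʳ i) (ℤP.+-monoʳ-< i (ℤ.+<+ (s≤s z≤n)))

  i+1≢i : ∀ i → i + 1ℤ ≢ i
  i+1≢i i eq = ℤP.<-irrefl (sym eq) (i<i+1 i)

  _≼_ : Cell → Cell → Set
  (x , y) ≼ (x′ , y′) = x ℤ.≤ x′ × y ℤ.≤ y′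

  ≼-refl : ∀ {z} → z ≼ z
  ≼-refl {_ , _} = ℤP.≤-refl , ℤP.≤-refl

  ≼-trans : ∀ {z w u} → z ≼ w → w ≼ u → z ≼ u
  ≼-trans {_ , _} {_ , _} {_ , _} (p , q) (p′ , q′) = ℤP.≤-trans p p′ , ℤP.≤-trans q q′

  ≼-right : ∀ z → z ≼ right z
  ≼-right (x , _) = ℤP.<⇒≤ (i<i+1 x) , ℤP.≤-refl

  ≼-above : ∀ z → z ≼ above z
  ≼-above (_ , y) = ℤP.≤-refl , ℤP.<⇒≤ (i<i+1 y)

  translation-sym : ∀ {P Q} → TranslationEquivalent P Q → TranslationEquivalent Q P
  translation-sym {P} {Q} (a , b , P⇔Q) = - a , - b , λ x y → mk⇔
    (λ q → Equivalence.from (P⇔Q (x - a) (y - b)) (subst (_∈ Q) (sym (-ᶜ+ᶜ (x , y) (a , b))) q))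
    (λ p → subst (_∈ Q) (-ᶜ+ᶜ (x , y) (a , b)) (Equivalence.to (P⇔Q (x - a) (y - b)) p))

  translation-trans : ∀ {P Q R} → TranslationEquivalent P Q → TranslationEquivalent Q R →
                      TranslationEquivalent P R
  translation-trans {P} {Q} {R} (a , b , P⇔Q) (a′ , b′ , Q⇔R) = a + a′ , b + b′ , λ x y → mk⇔
    (λ p → subst (_∈ R) (shift x y)
             (Equivalence.to (Q⇔R (x + a) (y + b)) (Equivalence.to (P⇔Q x y) p)))
    (λ r → Equivalence.from (P⇔Q x y)
             (Equivalence.from (Q⇔R (x + a) (y + b)) (subst (_∈ R) (sym (shift x y)) r)))
    where
    assoc : ∀ x a a′ → x + a + a′ ≡ x + (a + a′)
    assoc = solve-∀
    shift : ∀ x y → (x + a + a′ , y + b + b′) ≡ (x + (a + a′) , y + (b + b′))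
    shift x y = cong₂ _,_ (assoc x a a′) (assoc y b b′)

  unique-⊆⇒length≤ : ∀ {A B : List Cell} → Unique A → A ⊆ B → length A ℕ.≤ length B
  unique-⊆⇒length≤ {[]}    _          _   = z≤n
  unique-⊆⇒length≤ {a ∷ A} {B} (a∉A ∷ A!) A⊆B = ℕP.≤-trans (s≤s (unique-⊆⇒length≤ A! A⊆B′))
    (filter-notAll ≢a? B (Any.map (λ a≡ a≢ → a≢ (sym a≡)) (A⊆B (here refl))))
    where
    ≢a? = λ z → ¬? (z ≟ᶜ a)
    A⊆B′ : A ⊆ filter ≢a? B
    A⊆B′ z∈A = ∈-filter⁺ ≢a? (A⊆B (there z∈A)) (λ z≡a → All.lookup a∉A z∈A (sym z≡a))


module UpRightPaths where
  open CellGeometry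
  open import Data.List using (List)
  open import Data.List.Membership.Propositional using (_∈_)
  open import Data.List.Relation.Binary.Subset.Propositional using (_⊆_)
  open import Data.List.Relation.Unary.Any using (here; there)
  open import Data.Product using (_,_)
  open import Data.Sum using (_⊎_; inj₁; inj₂)
  open import Relation.Binary.PropositionalEquality

  data UpRight (P : List Cell) : Cell → Cell → Set where
    done     : ∀ {a}   → a ∈ P → UpRight P a a
    viaRight : ∀ {a b} → a ∈ P → UpRight P (right a) b → UpRight P a b
    viaAbove : ∀ {a b} → a ∈ P → UpRight P (above a) b → UpRight P a b

  UpRight-source : ∀ {P a b} → UpRight P a b → a ∈ P
  UpRight-source (done a∈P)       = a∈P
  UpRight-source (viaRight a∈P _) = a∈P
  UpRight-source (viaAbove a∈P _) = a∈P

  UpRight⇒≼ : ∀ {P a b} → UpRight P a b → a ≼ b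
  UpRight⇒≼         (done _)       = ≼-refl
  UpRight⇒≼ {a = a} (viaRight _ p) = ≼-trans (≼-right a) (UpRight⇒≼ p)
  UpRight⇒≼ {a = a} (viaAbove _ p) = ≼-trans (≼-above a) (UpRight⇒≼ p)

  UpRight-++ : ∀ {P a b c} → UpRight P a b → UpRight P b c → UpRight P a c
  UpRight-++ (done _)         q = q
  UpRight-++ (viaRight a∈P p) q = viaRight a∈P (UpRight-++ p q)
  UpRight-++ (viaAbove a∈P p) q = viaAbove a∈P (UpRight-++ p q)

  UpRight-snoc : ∀ {P a b c} → UpRight P a b → c ∈ P → c ≡ right b ⊎ c ≡ above b → UpRight P a c
  UpRight-snoc (done b∈P)       c∈P (inj₁ refl) = viaRight b∈P (done c∈P)
  UpRight-snoc (done b∈P)       c∈P (inj₂ refl) = viaAbove b∈P (done c∈P)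
  UpRight-snoc (viaRight a∈P p) c∈P move        = viaRight a∈P (UpRight-snoc p c∈P move)
  UpRight-snoc (viaAbove a∈P p) c∈P move        = viaAbove a∈P (UpRight-snoc p c∈P move)

  UpRight-restrict : ∀ {P Q a₀ a b} → (∀ {w} → w ∈ P → a₀ ≼ w → w ∈ Q) → a₀ ≼ a →
                     UpRight P a b → UpRight Q a b
  UpRight-restrict P⊆Q a₀≼a (done a∈P)       = done (P⊆Q a∈P a₀≼a)
  UpRight-restrict P⊆Q a₀≼a (viaRight a∈P p) =
    viaRight (P⊆Q a∈P a₀≼a) (UpRight-restrict P⊆Q (≼-trans a₀≼a (≼-right _)) p)
  UpRight-restrict P⊆Q a₀≼a (viaAbove a∈P p) =
    viaAbove (P⊆Q a∈P a₀≼a) (UpRight-restrict P⊆Q (≼-trans a₀≼a (≼-above _)) p)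

  UpRight-mono : ∀ {P Q a b} → P ⊆ Q → UpRight P a b → UpRight Q a b
  UpRight-mono P⊆Q = UpRight-restrict (λ w∈P _ → P⊆Q w∈P) ≼-refl

  source : ∀ {L} → Built L → Cell
  source (start c)    = c
  source (grow b _ _) = source b

  source-∈ : ∀ {L} (b : Built L) → source b ∈ L
  source-∈ (start c)    = here refl
  source-∈ (grow b _ _) = there (source-∈ b)

  Built⇒UpRight : ∀ {L} (b : Built L) {z} → z ∈ L → UpRight L (source b) z
  Built⇒UpRight (start c)                  (here refl) = done (here refl)
  Built⇒UpRight (grow b _ (d , d∈L , move)) (here refl) =
    UpRight-snoc (UpRight-mono there (Built⇒UpRight b d∈L)) (here refl) move
  Built⇒UpRight (grow b _ _)               (there z∈L) = UpRight-mono there (Built⇒UpRight b z∈L)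


module CodeCells where
  open Codes
  open CellGeometry
  open UpRightPaths using (source)
  open import Data.Nat as ℕ using (ℕ; zero; suc; s≤s; z≤n)
  import Data.Nat.Properties as ℕP
  open import Data.Integer as ℤ using (+_; 0ℤ; 1ℤ; _+_; _-_; +≤+)
  open import Data.Integer.Tactic.RingSolver using (solve-∀)
  import Data.Integer.Properties as ℤP
  open import Data.List using (List; []; _∷_; _++_; map; length)
  open import Data.List.Membership.Propositional using (_∈_; _∉_)
  open import Data.List.Membership.Propositional.Properties
    using (∈-map⁺; ∈-map⁻; ∈-++⁺ˡ; ∈-++⁺ʳ; ∈-++⁻)
  open import Data.List.Relation.Binary.Subset.Propositional using (_⊆_)
  open import Data.List.Relation.Unary.Any using (here; there)
  import Data.List.Relation.Unary.All as All
  open All using ([])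
  open import Data.List.Relation.Unary.AllPairs using ([]; _∷_)
  open import Data.List.Relation.Unary.Unique.Propositional using (Unique)
  import Data.List.Relation.Unary.Unique.Propositional.Properties as Unique
  open import Data.List.Properties using (length-map; length-++)
  open import Data.Product using (Σ; ∃; _×_; _,_; proj₁; proj₂; map₂)
  open import Data.Sum using (_⊎_; inj₁; inj₂)
  open import Data.Empty using (⊥-elim)
  open import Relation.Nullary using (¬_; yes; no)
  open import Relation.Binary.PropositionalEquality
  open import Function.Bundles using (Equivalence)

  columnCells : ℕ → List Cell
  columnCells zero    = origin ∷ []
  columnCells (suc p) = (0ℤ , + suc p) ∷ columnCells p

  cells : Code → List Cell
  cells single       = origin ∷ []
  cells (under c)    = map above (cells c) ++ origin ∷ []
  cells (column p c) = map right (cells c) ++ columnCells p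

  ∈-columnCells⁻ : ∀ p {z} → z ∈ columnCells p → ∃ λ j → j ℕ.≤ p × z ≡ (0ℤ , + j)
  ∈-columnCells⁻ zero    (here refl) = 0 , z≤n , refl
  ∈-columnCells⁻ (suc p) (here refl) = suc p , ℕP.≤-refl , refl
  ∈-columnCells⁻ (suc p) (there z∈) with ∈-columnCells⁻ p z∈
  ... | j , j≤p , refl = j , ℕP.m≤n⇒m≤1+n j≤p , refl

  ∈-columnCells⁺ : ∀ p {j} → j ℕ.≤ p → (0ℤ , + j) ∈ columnCells p
  ∈-columnCells⁺ zero    z≤n = here refl
  ∈-columnCells⁺ (suc p) {j} j≤p with ℕP.m≤n⇒m<n∨m≡n j≤p
  ... | inj₁ j<p  = there (∈-columnCells⁺ p (ℕP.≤-pred j<p))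
  ... | inj₂ refl = here refl

  ∈-cells-under⁻ : ∀ c {z} → z ∈ cells (under c) →
                   (∃ λ w → w ∈ cells c × z ≡ above w) ⊎ z ≡ origin
  ∈-cells-under⁻ c z∈ with ∈-++⁻ (map above (cells c)) z∈
  ... | inj₁ z∈map      = inj₁ (∈-map⁻ above z∈map)
  ... | inj₂ (here refl) = inj₂ refl

  ∈-cells-column⁻ : ∀ p c {z} → z ∈ cells (column p c) →
                    (∃ λ w → w ∈ cells c × z ≡ right w) ⊎ (∃ λ j → j ℕ.≤ p × z ≡ (0ℤ , + j))
  ∈-cells-column⁻ p c z∈ with ∈-++⁻ (map right (cells c)) z∈
  ... | inj₁ z∈map = inj₁ (∈-map⁻ right z∈map)
  ... | inj₂ z∈col = inj₂ (∈-columnCells⁻ p z∈col)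

  above-∈-cells-under : ∀ c {w} → w ∈ cells c → above w ∈ cells (under c)
  above-∈-cells-under c w∈ = ∈-++⁺ˡ (∈-map⁺ above w∈)

  right-∈-cells-column : ∀ p c {w} → w ∈ cells c → right w ∈ cells (column p c)
  right-∈-cells-column p c w∈ = ∈-++⁺ˡ (∈-map⁺ right w∈)

  column-∈-cells-column : ∀ p c {j} → j ℕ.≤ p → (0ℤ , + j) ∈ cells (column p c)
  column-∈-cells-column p c j≤p = ∈-++⁺ʳ (map right (cells c)) (∈-columnCells⁺ p j≤p)

  origin-∈-cells : ∀ c → origin ∈ cells c
  origin-∈-cells single       = here refl
  origin-∈-cells (under c)    = ∈-++⁺ʳ (map above (cells c)) (here refl)
  origin-∈-cells (column p c) = column-∈-cells-column p c z≤n

  Quadrant : Cell → Set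
  Quadrant (x , y) = 0ℤ ℤ.≤ x × 0ℤ ℤ.≤ y

  0≤i⇒0≤i+1 : ∀ {i} → 0ℤ ℤ.≤ i → 0ℤ ℤ.≤ i + 1ℤ
  0≤i⇒0≤i+1 {i} 0≤i = ℤP.≤-trans 0≤i (ℤP.<⇒≤ (i<i+1 i))

  0≤i⇒i+1≢0 : ∀ {i} → 0ℤ ℤ.≤ i → i + 1ℤ ≢ 0ℤ
  0≤i⇒i+1≢0 {i} 0≤i eq = ℤP.<-irrefl (sym eq) (ℤP.≤-<-trans 0≤i (i<i+1 i))

  cells-quadrant : ∀ c {z} → z ∈ cells c → Quadrant z
  cells-quadrant single (here refl) = ℤP.≤-refl , ℤP.≤-refl
  cells-quadrant (under c) z∈ with ∈-cells-under⁻ c z∈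
  ... | inj₁ (_ , w∈ , refl) = let (0≤x , 0≤y) = cells-quadrant c w∈ in 0≤x , 0≤i⇒0≤i+1 0≤y
  ... | inj₂ refl            = ℤP.≤-refl , ℤP.≤-refl
  cells-quadrant (column p c) z∈ with ∈-cells-column⁻ p c z∈
  ... | inj₁ (_ , w∈ , refl) = let (0≤x , 0≤y) = cells-quadrant c w∈ in 0≤i⇒0≤i+1 0≤x , 0≤y
  ... | inj₂ (_ , _ , refl)  = ℤP.≤-refl , +≤+ z≤n

  above-cells≢origin : ∀ c {w} → w ∈ cells c → above w ≢ origin
  above-cells≢origin c w∈ eq = 0≤i⇒i+1≢0 (proj₂ (cells-quadrant c w∈)) (cong proj₂ eq)

  right-cells∉columnCells : ∀ c p {w} → w ∈ cells c → right w ∉ columnCells p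
  right-cells∉columnCells c p w∈ r∈ with ∈-columnCells⁻ p r∈
  ... | _ , _ , eq = 0≤i⇒i+1≢0 (proj₁ (cells-quadrant c w∈)) (cong proj₁ eq)

  length-columnCells : ∀ p → length (columnCells p) ≡ suc p
  length-columnCells zero    = refl
  length-columnCells (suc p) = cong suc (length-columnCells p)

  length-cells : ∀ c → length (cells c) ≡ size c
  length-cells single = refl
  length-cells (under c) = begin
    length (map above (cells c) ++ origin ∷ []) ≡⟨ length-++ (map above (cells c)) ⟩
    length (map above (cells c)) ℕ.+ 1          ≡⟨ cong (ℕ._+ 1) (length-map above (cells c)) ⟩
    length (cells c) ℕ.+ 1                      ≡⟨ cong (ℕ._+ 1) (length-cells c) ⟩
    size c ℕ.+ 1                                ≡⟨ ℕP.+-comm (size c) 1 ⟩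
    size (under c)                              ∎
    where open ≡-Reasoning
  length-cells (column p c) = begin
    length (map right (cells c) ++ columnCells p)
      ≡⟨ length-++ (map right (cells c)) ⟩
    length (map right (cells c)) ℕ.+ length (columnCells p)
      ≡⟨ cong₂ ℕ._+_ (length-map right (cells c)) (length-columnCells p) ⟩
    length (cells c) ℕ.+ suc p
      ≡⟨ cong (ℕ._+ suc p) (length-cells c) ⟩
    size c ℕ.+ suc p
      ≡⟨ ℕP.+-comm (size c) (suc p) ⟩
    size (column p c) ∎
    where open ≡-Reasoning

  columnCells-unique : ∀ p → Unique (columnCells p)
  columnCells-unique zero    = [] ∷ []
  columnCells-unique (suc p) = All.tabulate top≢ ∷ columnCells-unique p
    where
    top≢ : ∀ {z} → z ∈ columnCells p → (0ℤ , + suc p) ≢ z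
    top≢ z∈ eq with ∈-columnCells⁻ p z∈
    ... | _ , j≤p , refl = ℕP.<-irrefl (sym (ℤP.+-injective (cong proj₂ eq))) (s≤s j≤p)

  cells-unique : ∀ c → Unique (cells c)
  cells-unique single = [] ∷ []
  cells-unique (under c) =
    Unique.++⁺ (Unique.map⁺ above-injective (cells-unique c)) ([] ∷ []) disjoint
    where
    disjoint : ∀ {z} → ¬ (z ∈ map above (cells c) × z ∈ origin ∷ [])
    disjoint (z∈ , here refl) with ∈-map⁻ above z∈
    ... | _ , w∈ , eq = above-cells≢origin c w∈ (sym eq)
  cells-unique (column p c) =
    Unique.++⁺ (Unique.map⁺ right-injective (cells-unique c)) (columnCells-unique p) disjoint
    where
    disjoint : ∀ {z} → ¬ (z ∈ map right (cells c) × z ∈ columnCells p)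
    disjoint (z∈ , z∈col) with ∈-map⁻ right z∈
    ... | _ , w∈ , refl = right-cells∉columnCells c p w∈ z∈col

  +1-1 : ∀ y → y + 1ℤ - 1ℤ ≡ y
  +1-1 = solve-∀

  -1+1 : ∀ y → y - 1ℤ + 1ℤ ≡ y
  -1+1 = solve-∀

  ≤-1 : ∀ {a b} → a ℤ.≤ b → a - 1ℤ ℤ.≤ b - 1ℤ
  ≤-1 = ℤP.+-monoˡ-≤ (ℤ.- 1ℤ)

  0≤i≢0⇒0≤i-1 : ∀ {i} → 0ℤ ℤ.≤ i → i ≢ 0ℤ → 0ℤ ℤ.≤ i - 1ℤ
  0≤i≢0⇒0≤i-1 (+≤+ {n = zero}  z≤n) i≢0 = ⊥-elim (i≢0 refl)
  0≤i≢0⇒0≤i-1 (+≤+ {n = suc _} z≤n) _   = +≤+ z≤n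

  above-y-1 : ∀ c x y → (x , y - 1ℤ) ∈ cells c → (x , y) ∈ cells (under c)
  above-y-1 c x y z∈ = subst (λ y′ → (x , y′) ∈ cells (under c)) (-1+1 y) (above-∈-cells-under c z∈)

  cells-columnConvex : ∀ c → ColumnConvex (cells c)
  cells-columnConvex single x y₁ y₂ y (here refl) (here refl) y₁≤y y≤y₂ =
    here (cong (0ℤ ,_) (ℤP.≤-antisym y≤y₂ y₁≤y))
  cells-columnConvex (under c) x y₁ y₂ y z₁∈ z₂∈ y₁≤y y≤y₂
    with ∈-cells-under⁻ c z₁∈ | ∈-cells-under⁻ c z₂∈
  ... | _ | inj₂ refl =
    subst (λ y′ → (0ℤ , y′) ∈ cells (under c))
      (ℤP.≤-antisym (ℤP.≤-trans (proj₂ (cells-quadrant (under c) z₁∈)) y₁≤y) y≤y₂)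
      (origin-∈-cells (under c))
  ... | inj₁ ((_ , y₁′) , w₁∈ , refl) | inj₁ ((_ , y₂′) , w₂∈ , refl) =
    above-y-1 c x y (cells-columnConvex c x y₁′ y₂′ (y - 1ℤ) w₁∈ w₂∈
      (subst (ℤ._≤ y - 1ℤ) (+1-1 y₁′) (≤-1 y₁≤y))
      (subst (y - 1ℤ ℤ.≤_) (+1-1 y₂′) (≤-1 y≤y₂)))
  ... | inj₂ refl | inj₁ ((_ , y₂′) , w₂∈ , refl) with y ℤ.≟ 0ℤ
  ...   | yes y≡0  = subst (λ y′ → (0ℤ , y′) ∈ cells (under c)) (sym y≡0) (origin-∈-cells (under c))
  ...   | no  y≢0  =
    above-y-1 c 0ℤ y (cells-columnConvex c 0ℤ 0ℤ y₂′ (y - 1ℤ) (origin-∈-cells c) w₂∈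
      (0≤i≢0⇒0≤i-1 y₁≤y y≢0) (subst (y - 1ℤ ℤ.≤_) (+1-1 y₂′) (≤-1 y≤y₂)))
  cells-columnConvex (column p c) x y₁ y₂ y z₁∈ z₂∈ y₁≤y y≤y₂
    with ∈-cells-column⁻ p c z₁∈ | ∈-cells-column⁻ p c z₂∈
  ... | inj₁ ((x′ , _) , w₁∈ , refl) | inj₁ (w₂ , w₂∈ , eq) =
    right-∈-cells-column p c (cells-columnConvex c x′ y₁ y₂ y w₁∈
      (subst (_∈ cells c) (sym (right-injective eq)) w₂∈) y₁≤y y≤y₂)
  ... | inj₁ (_ , w₁∈ , refl) | inj₂ (_ , _ , eq) =
    ⊥-elim (0≤i⇒i+1≢0 (proj₁ (cells-quadrant c w₁∈)) (cong proj₁ eq))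
  ... | inj₂ (_ , _ , refl) | inj₁ (_ , w₂∈ , eq) =
    ⊥-elim (0≤i⇒i+1≢0 (proj₁ (cells-quadrant c w₂∈)) (sym (cong proj₁ eq)))
  ... | inj₂ (_ , _ , refl) | inj₂ (_ , j₂≤p , refl) with ℤP.≤-trans (+≤+ z≤n) y₁≤y
  ...   | +≤+ _ = column-∈-cells-column p c (ℕP.≤-trans (ℤP.drop‿+≤+ y≤y₂) j₂≤p)

  Adjacent-sym : ∀ {a b} → Adjacent a b → Adjacent b a
  Adjacent-sym (inj₁ (eq , inj₁ e)) = inj₁ (sym eq , inj₂ e)
  Adjacent-sym (inj₁ (eq , inj₂ e)) = inj₁ (sym eq , inj₁ e)
  Adjacent-sym (inj₂ (eq , inj₁ e)) = inj₂ (sym eq , inj₂ e)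
  Adjacent-sym (inj₂ (eq , inj₂ e)) = inj₂ (sym eq , inj₁ e)

  Adjacent-above : ∀ {a b} → Adjacent a b → Adjacent (above a) (above b)
  Adjacent-above (inj₁ (eq , e)) = inj₁ (cong (_+ 1ℤ) eq , e)
  Adjacent-above (inj₂ (eq , inj₁ e)) = inj₂ (eq , inj₁ (cong (_+ 1ℤ) e))
  Adjacent-above (inj₂ (eq , inj₂ e)) = inj₂ (eq , inj₂ (cong (_+ 1ℤ) e))

  Adjacent-right : ∀ {a b} → Adjacent a b → Adjacent (right a) (right b)
  Adjacent-right (inj₁ (eq , inj₁ e)) = inj₁ (eq , inj₁ (cong (_+ 1ℤ) e))
  Adjacent-right (inj₁ (eq , inj₂ e)) = inj₁ (eq , inj₂ (cong (_+ 1ℤ) e))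
  Adjacent-right (inj₂ (eq , e)) = inj₂ (cong (_+ 1ℤ) eq , e)

  PathIn-snoc : ∀ {L a b c} → PathIn L a b → Adjacent b c → c ∈ L → PathIn L a c
  PathIn-snoc (here b∈L)       b~c c∈L = step b∈L b~c (here c∈L)
  PathIn-snoc (step a∈L a~ p) b~c c∈L = step a∈L a~ (PathIn-snoc p b~c c∈L)

  PathIn-++ : ∀ {L a b c} → PathIn L a b → PathIn L b c → PathIn L a c
  PathIn-++ (here _)          q = q
  PathIn-++ (step a∈L a~ p) q = step a∈L a~ (PathIn-++ p q)

  PathIn-reverse : ∀ {L a b} → PathIn L a b → PathIn L b a
  PathIn-reverse (here a∈L)       = here a∈L
  PathIn-reverse (step a∈L a~ p) = PathIn-snoc (PathIn-reverse p) (Adjacent-sym a~) a∈L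

  PathIn-mono : ∀ {L M a b} → L ⊆ M → PathIn L a b → PathIn M a b
  PathIn-mono L⊆M (here a∈L)       = here (L⊆M a∈L)
  PathIn-mono L⊆M (step a∈L a~ p) = step (L⊆M a∈L) a~ (PathIn-mono L⊆M p)

  PathIn-map : ∀ {L a b} (t : Cell → Cell) → (∀ {a b} → Adjacent a b → Adjacent (t a) (t b)) →
               PathIn L a b → PathIn (map t L) (t a) (t b)
  PathIn-map t t-adj (here a∈L)       = here (∈-map⁺ t a∈L)
  PathIn-map t t-adj (step a∈L a~ p) = step (∈-map⁺ t a∈L) (t-adj a~) (PathIn-map t t-adj p)

  columnCells-path : ∀ p {z} → z ∈ columnCells p → PathIn (columnCells p) z origin
  columnCells-path zero    (here refl) = here (here refl)
  columnCells-path (suc p) (here refl) =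
    step (here refl) (inj₂ (refl , inj₂ (cong +_ (ℕP.+-comm 1 p))))
      (PathIn-mono there (columnCells-path p (∈-columnCells⁺ p ℕP.≤-refl)))
  columnCells-path (suc p) (there z∈) = PathIn-mono there (columnCells-path p z∈)

  path-to-origin : ∀ c {z} → z ∈ cells c → PathIn (cells c) z origin
  path-to-origin single (here refl) = here (here refl)
  path-to-origin (under c) z∈ with ∈-cells-under⁻ c z∈
  ... | inj₂ refl = here z∈
  ... | inj₁ (_ , w∈ , refl) =
    PathIn-snoc (PathIn-mono ∈-++⁺ˡ (PathIn-map above Adjacent-above (path-to-origin c w∈)))
      (inj₂ (refl , inj₂ refl)) (origin-∈-cells (under c))
  path-to-origin (column p c) z∈ with ∈-cells-column⁻ p c z∈
  ... | inj₂ (_ , j≤p , refl) =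
    PathIn-mono (∈-++⁺ʳ (map right (cells c))) (columnCells-path p (∈-columnCells⁺ p j≤p))
  ... | inj₁ (_ , w∈ , refl) =
    PathIn-snoc (PathIn-mono ∈-++⁺ˡ (PathIn-map right Adjacent-right (path-to-origin c w∈)))
      (inj₁ (refl , inj₂ refl)) (origin-∈-cells (column p c))

  cells-connected : ∀ c → EdgeConnected (cells c)
  cells-connected c z∈ w∈ = PathIn-++ (path-to-origin c z∈) (PathIn-reverse (path-to-origin c w∈))

  Built-map-++ : ∀ {L K s} (t : Cell → Cell) → (∀ {a b} → t a ≡ t b → a ≡ b) →
                 (∀ d → t (right d) ≡ right (t d)) → (∀ d → t (above d) ≡ above (t d)) →
                 (b : Built L) → source b ≡ s → (bK : Built (t s ∷ K)) → (∀ {z} → z ∈ L → t z ∉ K) →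
                 Σ (Built (map t L ++ K)) λ b′ → source b′ ≡ source bK
  Built-map-++ t _ _ _ (start c) refl bK _ = bK , refl
  Built-map-++ {c ∷ L} {K} t t-inj t-right t-above (grow b c∉L (d , d∈L , move)) src bK disjoint =
    grow (proj₁ rest) tc∉ (t d , ∈-++⁺ˡ (∈-map⁺ t d∈L) , t-move move) , proj₂ rest
    where
    rest = Built-map-++ t t-inj t-right t-above b src bK (λ z∈ → disjoint (there z∈))
    tc∉ : t c ∉ map t L ++ K
    tc∉ tc∈ with ∈-++⁻ (map t L) tc∈
    ... | inj₂ tc∈K = disjoint (here refl) tc∈K
    ... | inj₁ tc∈map with ∈-map⁻ t tc∈map
    ...   | w , w∈L , tc≡tw = c∉L (subst (_∈ L) (sym (t-inj tc≡tw)) w∈L)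
    t-move : c ≡ right d ⊎ c ≡ above d → t c ≡ right (t d) ⊎ t c ≡ above (t d)
    t-move (inj₁ refl) = inj₁ (t-right d)
    t-move (inj₂ refl) = inj₂ (t-above d)

  columnCells-built : ∀ p → Σ (Built (columnCells p)) λ b → source b ≡ origin
  columnCells-built zero    = start origin , refl
  columnCells-built (suc p) =
    grow (proj₁ (columnCells-built p)) top∉
      ((0ℤ , + p) , ∈-columnCells⁺ p ℕP.≤-refl , inj₂ (cong (0ℤ ,_) (cong +_ (ℕP.+-comm 1 p)))) ,
    proj₂ (columnCells-built p)
    where
    top∉ : (0ℤ , + suc p) ∉ columnCells p
    top∉ top∈ with ∈-columnCells⁻ p top∈
    ... | _ , j≤p , eq = ℕP.<-irrefl (sym (ℤP.+-injective (cong proj₂ eq))) (s≤s j≤p)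

  cells-built : ∀ c → Σ (Built (cells c)) λ b → source b ≡ origin
  cells-built single = start origin , refl
  cells-built (under c) with cells-built c
  ... | b , src =
    Built-map-++ above above-injective (λ _ → refl) (λ _ → refl) b src
      (grow (start origin) (λ { (here ()) ; (there ()) }) (origin , here refl , inj₂ refl))
      (λ { w∈ (here eq) → above-cells≢origin c w∈ eq ; _ (there ()) })
  cells-built (column p c) with cells-built c | columnCells-built p
  ... | b , src | bcol , srccol =
    map₂ (λ eq → trans eq srccol)
      (Built-map-++ right right-injective (λ _ → refl) (λ _ → refl) b src
        (grow bcol (right-cells∉columnCells single p (here refl)) (origin , ∈-columnCells⁺ p z≤n , inj₁ refl))
        (right-cells∉columnCells c p))

  right-origin∉under : ∀ c → right origin ∉ cells (under c)
  right-origin∉under c r∈ with ∈-cells-under⁻ c r∈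
  ... | inj₁ (_ , w∈ , eq) = 0≤i⇒i+1≢0 (proj₂ (cells-quadrant c w∈)) (sym (cong proj₂ eq))
  ... | inj₂ ()

  column-height : ∀ p c {j} → (0ℤ , + j) ∈ cells (column p c) → j ℕ.≤ p
  column-height p c z∈ with ∈-cells-column⁻ p c z∈
  ... | inj₁ (_ , w∈ , eq) = ⊥-elim (0≤i⇒i+1≢0 (proj₁ (cells-quadrant c w∈)) (sym (cong proj₁ eq)))
  ... | inj₂ (_ , j≤p , refl) = j≤p

  under-⊆ : ∀ c c′ → cells (under c) ⊆ cells (under c′) → cells c ⊆ cells c′
  under-⊆ c c′ ⊆′ w∈ with ∈-cells-under⁻ c′ (⊆′ (above-∈-cells-under c w∈))
  ... | inj₁ (_ , w′∈ , eq) = subst (_∈ cells c′) (sym (above-injective eq)) w′∈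
  ... | inj₂ eq = ⊥-elim (above-cells≢origin c w∈ eq)

  column-⊆ : ∀ p c c′ → cells (column p c) ⊆ cells (column p c′) → cells c ⊆ cells c′
  column-⊆ p c c′ ⊆′ w∈ with ∈-cells-column⁻ p c′ (⊆′ (right-∈-cells-column p c w∈))
  ... | inj₁ (_ , w′∈ , eq) = subst (_∈ cells c′) (sym (right-injective eq)) w′∈
  ... | inj₂ (_ , j≤p , eq) =
    ⊥-elim (right-cells∉columnCells c p w∈ (subst (_∈ columnCells p) (sym eq) (∈-columnCells⁺ p j≤p)))

  cells-injective : ∀ c c′ → cells c ⊆ cells c′ → cells c′ ⊆ cells c → c ≡ c′
  cells-injective single single _ _ = refl
  cells-injective single (under c′) _ c′⊆c with c′⊆c (above-∈-cells-under c′ (origin-∈-cells c′))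
  ... | here ()
  cells-injective single (column q c′) _ c′⊆c with c′⊆c (right-∈-cells-column q c′ (origin-∈-cells c′))
  ... | here ()
  cells-injective (under c) single c⊆c′ _ with c⊆c′ (above-∈-cells-under c (origin-∈-cells c))
  ... | here ()
  cells-injective (column p c) single c⊆c′ _ with c⊆c′ (right-∈-cells-column p c (origin-∈-cells c))
  ... | here ()
  cells-injective (under c) (column q c′) _ c′⊆c =
    ⊥-elim (right-origin∉under c (c′⊆c (right-∈-cells-column q c′ (origin-∈-cells c′))))
  cells-injective (column p c) (under c′) c⊆c′ _ =
    ⊥-elim (right-origin∉under c′ (c⊆c′ (right-∈-cells-column p c (origin-∈-cells c))))
  cells-injective (under c) (under c′) c⊆c′ c′⊆c =
    cong under (cells-injective c c′ (under-⊆ c c′ c⊆c′) (under-⊆ c′ c c′⊆c))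
  cells-injective (column p c) (column q c′) c⊆c′ c′⊆c
    with ℕP.≤-antisym (column-height q c′ (c⊆c′ (column-∈-cells-column p c ℕP.≤-refl)))
                      (column-height p c (c′⊆c (column-∈-cells-column q c′ ℕP.≤-refl)))
  ... | refl = cong (column p) (cells-injective c c′ (column-⊆ p c c′ c⊆c′) (column-⊆ p c′ c c′⊆c))

  -- Both cell sets have the origin as their lowest-leftmost cell, so the
  -- translation vector (a , b) and its negation are both nonnegative.
  translation-rigid : ∀ c c′ → TranslationEquivalent (cells c) (cells c′) → c ≡ c′
  translation-rigid c c′ (a , b , c⇔c′) = cells-injective c c′ c⊆c′ c′⊆c
    where
    0≤a,b : Quadrant (a , b)
    0≤a,b = subst Quadrant (cong₂ _,_ (ℤP.+-identityˡ a) (ℤP.+-identityˡ b))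
      (cells-quadrant c′ (Equivalence.to (c⇔c′ 0ℤ 0ℤ) (origin-∈-cells c)))
    -a,-b∈ : (ℤ.- a , ℤ.- b) ∈ cells c
    -a,-b∈ = Equivalence.from (c⇔c′ (ℤ.- a) (ℤ.- b))
      (subst (_∈ cells c′) (sym (cong₂ _,_ (ℤP.+-inverseˡ a) (ℤP.+-inverseˡ b))) (origin-∈-cells c′))
    ≡0 : ∀ {i} → 0ℤ ℤ.≤ i → 0ℤ ℤ.≤ ℤ.- i → i ≡ 0ℤ
    ≡0 {+ zero}  _ _  = refl
    ≡0 {+ suc _} _ ()
    a≡0 = ≡0 (proj₁ 0≤a,b) (proj₁ (cells-quadrant c -a,-b∈))
    b≡0 = ≡0 (proj₂ 0≤a,b) (proj₂ (cells-quadrant c -a,-b∈))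
    unshift : ∀ x y → (x + a , y + b) ≡ (x , y)
    unshift x y = cong₂ _,_ (trans (cong (λ t → x + t) a≡0) (ℤP.+-identityʳ x))
                            (trans (cong (λ t → y + t) b≡0) (ℤP.+-identityʳ y))
    c⊆c′ : cells c ⊆ cells c′
    c⊆c′ {x , y} z∈ = subst (_∈ cells c′) (unshift x y) (Equivalence.to (c⇔c′ x y) z∈)
    c′⊆c : cells c′ ⊆ cells c
    c′⊆c {x , y} z∈ = Equivalence.from (c⇔c′ x y) (subst (_∈ cells c′) (sym (unshift x y)) z∈)


module Classification where
  open Codes
  open CellGeometry
  open UpRightPaths
  open CodeCells
  open import Data.Nat as ℕ using (ℕ; zero; suc; s≤s; z≤n)
  import Data.Nat.Properties as ℕP
  open import Data.Nat.Induction using (<-wellFounded)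
  open import Induction.WellFounded using (Acc; acc)
  open import Data.Integer as ℤ using (ℤ; +_; 0ℤ; 1ℤ; _+_; _-_; +≤+)
  import Data.Integer.Properties as ℤP
  open import Data.Integer.Tactic.RingSolver using (solve-∀)
  open import Data.List using (List; filter; length; applyUpTo)
  open import Data.List.Membership.Propositional using (_∈_; _∉_)
  open import Data.List.Membership.Propositional.Properties
    using (∈-filter⁺; ∈-filter⁻; ∈-applyUpTo⁻)
  open import Data.List.Membership.DecPropositional _≟ᶜ_ using (_∈?_)
  open import Data.List.Relation.Binary.Subset.Propositional using (_⊆_)
  open import Data.List.Relation.Unary.Any using (here)
  import Data.List.Relation.Unary.Any as Any
  import Data.List.Relation.Unary.Unique.Propositional.Properties as Unique
  open import Data.List.Properties using (filter-notAll; length-applyUpTo)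
  open import Data.Product using (∃; _×_; _,_; proj₁; proj₂)
  open import Data.Sum using (_⊎_; inj₁; inj₂; [_,_]′)
  open import Data.Empty using (⊥-elim)
  open import Relation.Nullary using (¬_; yes; no; Dec; ¬?)
  open import Relation.Binary.PropositionalEquality
  open import Function.Bundles using (_⇔_; mk⇔; Equivalence)

  first-failure : ∀ {Q : ℕ → Set} → (∀ j → Dec (Q j)) → ∀ N →
                  (∀ j → j ℕ.< N → Q j) ⊎ (∃ λ m → m ℕ.< N × ¬ Q m × (∀ j → j ℕ.< m → Q j))
  first-failure Q? zero = inj₁ λ _ ()
  first-failure Q? (suc N) with first-failure Q? N
  ... | inj₂ (m , m<N , ¬Qm , below) = inj₂ (m , ℕP.m≤n⇒m≤1+n m<N , ¬Qm , below)
  ... | inj₁ below with Q? N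
  ...   | no  ¬QN = inj₂ (N , ℕP.≤-refl , ¬QN , below)
  ...   | yes QN  = inj₁ λ j j<1+N →
    [ below j , (λ { refl → QN }) ]′ (ℕP.m≤n⇒m<n∨m≡n (ℕP.≤-pred j<1+N))

  -- The cells above (x , y) in a finite list cannot all be present, since
  -- length P + 1 of them are distinct.
  column-top : ∀ {P} x y → (x , y) ∈ P →
               ∃ λ p → (∀ j → j ℕ.≤ p → (x , y + + j) ∈ P) × (x , y + + suc p) ∉ P
  column-top {P} x y s∈P with first-failure (λ j → (x , y + + j) ∈? P) (suc (length P))
  ... | inj₁ all = ⊥-elim (ℕP.<-irrefl refl
          (subst (ℕ._≤ length P) (length-applyUpTo cell (suc (length P)))
            (unique-⊆⇒length≤ (Unique.applyUpTo⁺₁ cell (suc (length P)) distinct) ⊆P)))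
    where
    cell : ℕ → Cell
    cell j = x , y + + j
    distinct : ∀ {i j} → i ℕ.< j → j ℕ.< suc (length P) → cell i ≢ cell j
    distinct i<j _ eq = ℕP.<⇒≢ i<j (ℤP.+-injective (+-cancelˡ y (cong proj₂ eq)))
    ⊆P : applyUpTo cell (suc (length P)) ⊆ P
    ⊆P z∈ with ∈-applyUpTo⁻ cell z∈
    ... | j , j<N , refl = all j j<N
  ... | inj₂ (zero , _ , ¬Q0 , _) =
    ⊥-elim (¬Q0 (subst (λ y′ → (x , y′) ∈ P) (sym (ℤP.+-identityʳ y)) s∈P))
  ... | inj₂ (suc p , _ , ¬Q , below) = p , (λ j j≤p → below j (s≤s j≤p)) , ¬Q

  climb : ∀ {Q} → ColumnConvex Q → ∀ x y j → (x , y) ∈ Q → (x , y + + j) ∈ Q →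
          UpRight Q (x , y) (x , y + + j)
  climb {Q} convex x y zero bottom∈ _ =
    subst (λ y′ → UpRight Q (x , y) (x , y′)) (sym (ℤP.+-identityʳ y)) (done bottom∈)
  climb {Q} convex x y (suc j) bottom∈ top∈ =
    viaAbove bottom∈ (subst (λ y′ → UpRight Q (x , y + 1ℤ) (x , y′)) (assoc y (+ j))
      (climb convex x (y + 1ℤ) j next∈ (subst (λ y′ → (x , y′) ∈ Q) (sym (assoc y (+ j))) top∈)))
    where
    assoc : ∀ y t → y + 1ℤ + t ≡ y + (1ℤ + t)
    assoc = solve-∀
    next∈ : (x , y + 1ℤ) ∈ Q
    next∈ = convex x y (y + + suc j) (y + 1ℤ) bottom∈ top∈
              (ℤP.<⇒≤ (i<i+1 y)) (ℤP.+-monoʳ-≤ y (+≤+ (s≤s z≤n)))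

  exit-column : ∀ {P a z} → UpRight P a z → proj₁ z ≢ proj₁ a →
                ∃ λ j → UpRight P (proj₁ a + 1ℤ , proj₂ a + + j) z
  exit-column (done _) z≢a = ⊥-elim (z≢a refl)
  exit-column {P} {x , y} {z} (viaRight _ p) _ =
    0 , subst (λ y′ → UpRight P (x + 1ℤ , y′) z) (sym (ℤP.+-identityʳ y)) p
  exit-column {P} {x , y} {z} (viaAbove _ p) z≢a with exit-column p z≢a
  ... | j , q = suc j , subst (λ y′ → UpRight P (x + 1ℤ , y′) z) (assoc y (+ j)) q
    where
    assoc : ∀ y t → y + 1ℤ + t ≡ y + (1ℤ + t)
    assoc = solve-∀

  UpRight-stuck : ∀ {P s z} → UpRight P s z → right s ∉ P → above s ∉ P → z ≡ s
  UpRight-stuck (done _)       _    _    = refl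
  UpRight-stuck (viaRight _ p) r∉P _    = ⊥-elim (r∉P (UpRight-source p))
  UpRight-stuck (viaAbove _ p) _    a∉P = ⊥-elim (a∉P (UpRight-source p))

  record Rooted (P : List Cell) (s : Cell) : Set where
    field
      source∈P  : s ∈ P
      convex    : ColumnConvex P
      reachable : ∀ {z} → z ∈ P → UpRight P s z

  Encodes : List Cell → Cell → Code → Set
  Encodes P s c = ∀ z → z ∈ P ⇔ z -ᶜ s ∈ cells c

  _without_ : List Cell → Cell → List Cell
  P without s = filter (λ z → ¬? (z ≟ᶜ s)) P

  _withoutColumn_ : List Cell → ℤ → List Cell
  P withoutColumn x = filter (λ z → ¬? (proj₁ z ℤ.≟ x)) P

  length-without : ∀ {P s} → s ∈ P → length (P without s) ℕ.< length P
  length-without {P} s∈P = filter-notAll _ P (Any.map (λ { refl s≢s → s≢s refl }) s∈P)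

  length-withoutColumn : ∀ {P z} → z ∈ P → length (P withoutColumn proj₁ z) ℕ.< length P
  length-withoutColumn {P} z∈P = filter-notAll _ P (Any.map (λ { refl z≢z → z≢z refl }) z∈P)

  withoutColumn-convex : ∀ {P} x₀ → ColumnConvex P → ColumnConvex (P withoutColumn x₀)
  withoutColumn-convex x₀ convex x y₁ y₂ y z₁∈ z₂∈ y₁≤y y≤y₂ =
    let (z₁∈P , x≢x₀) = ∈-filter⁻ _ z₁∈ in
    ∈-filter⁺ _ (convex x y₁ y₂ y z₁∈P (proj₁ (∈-filter⁻ _ z₂∈)) y₁≤y y≤y₂) x≢x₀

  encode-single : ∀ {P s} → Rooted P s → right s ∉ P → above s ∉ P → Encodes P s single
  encode-single {P} {s} R r∉P a∉P z = mk⇔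
    (λ z∈P → here (trans (cong (_-ᶜ s) (UpRight-stuck (reachable z∈P) r∉P a∉P)) (-ᶜ-self s)))
    (λ { (here eq) → subst (_∈ P) (sym (-ᶜ≡origin⇒≡ s eq)) source∈P })
    where open Rooted R

  without-source-rooted : ∀ {P s} → Rooted P s → right s ∉ P → above s ∈ P →
                          Rooted (P without s) (above s)
  without-source-rooted {P} {s@(sx , sy)} R r∉P a∈P = record
    { source∈P  = ∈-filter⁺ _ a∈P (λ eq → i+1≢i sy (cong proj₂ eq))
    ; convex    = convex′
    ; reachable = reachable′
    }
    where
    open Rooted R
    convex′ : ColumnConvex (P without s)
    convex′ x y₁ y₂ y z₁∈ z₂∈ y₁≤y y≤y₂ =
      let (z₁∈P , z₁≢s) = ∈-filter⁻ _ z₁∈ in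
      ∈-filter⁺ _ (convex x y₁ y₂ y z₁∈P (proj₁ (∈-filter⁻ _ z₂∈)) y₁≤y y≤y₂)
        (λ eq → z₁≢s (cong₂ _,_ (cong proj₁ eq)
          (ℤP.≤-antisym (subst (y₁ ℤ.≤_) (cong proj₂ eq) y₁≤y)
                        (proj₂ (UpRight⇒≼ (reachable z₁∈P))))))
    above⇒≢s : ∀ {w} → w ∈ P → above s ≼ w → w ∈ P without s
    above⇒≢s w∈P (_ , sy+1≤) = ∈-filter⁺ _ w∈P
      (λ { refl → ℤP.<-irrefl refl (ℤP.<-≤-trans (i<i+1 sy) sy+1≤) })
    reachable′ : ∀ {z} → z ∈ P without s → UpRight (P without s) (above s) z
    reachable′ z∈ with ∈-filter⁻ _ z∈
    ... | z∈P , z≢s with reachable z∈P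
    ...   | done _       = ⊥-elim (z≢s refl)
    ...   | viaRight _ p = ⊥-elim (r∉P (UpRight-source p))
    ...   | viaAbove _ p = UpRight-restrict above⇒≢s ≼-refl p

  encode-under : ∀ {P s c} → s ∈ P → Encodes (P without s) (above s) c → Encodes P s (under c)
  encode-under {P} {s} {c} s∈P enc z = mk⇔ to from
    where
    to : z ∈ P → z -ᶜ s ∈ cells (under c)
    to z∈P with z ≟ᶜ s
    ... | yes refl = subst (_∈ cells (under c)) (sym (-ᶜ-self s)) (origin-∈-cells (under c))
    ... | no  z≢s  = subst (_∈ cells (under c)) (above-ᶜ z s)
                       (above-∈-cells-under c (Equivalence.to (enc z) (∈-filter⁺ _ z∈P z≢s)))
    from : z -ᶜ s ∈ cells (under c) → z ∈ P
    from z∈ with ∈-cells-under⁻ c z∈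
    ... | inj₂ eq = subst (_∈ P) (sym (-ᶜ≡origin⇒≡ s eq)) s∈P
    ... | inj₁ (w , w∈ , eq) = proj₁ (∈-filter⁻ _ (Equivalence.from (enc z)
          (subst (_∈ cells c) (above-injective (trans (sym eq) (sym (above-ᶜ z s)))) w∈)))

  without-column-rooted : ∀ {P s} → Rooted P s → right s ∈ P →
                          Rooted (P withoutColumn proj₁ s) (right s)
  without-column-rooted {P} {s@(sx , sy)} R r∈P = record
    { source∈P  = r∈P′
    ; convex    = convex′
    ; reachable = reachable′
    }
    where
    open Rooted R
    convex′ = withoutColumn-convex sx convex
    r∈P′ : right s ∈ P withoutColumn sx
    r∈P′ = ∈-filter⁺ _ r∈P (i+1≢i sx)
    beyond⇒∈ : ∀ j {w} → w ∈ P → (sx + 1ℤ , sy + + j) ≼ w → w ∈ P withoutColumn sx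
    beyond⇒∈ j w∈P (sx+1≤ , _) = ∈-filter⁺ _ w∈P
      (λ eq → ℤP.<-irrefl refl (ℤP.<-≤-trans (i<i+1 sx) (subst (sx + 1ℤ ℤ.≤_) eq sx+1≤)))
    reachable′ : ∀ {z} → z ∈ P withoutColumn sx → UpRight (P withoutColumn sx) (right s) z
    reachable′ z∈ with ∈-filter⁻ _ z∈
    ... | z∈P , z∉column with exit-column (reachable z∈P) z∉column
    ...   | j , p = UpRight-++ (climb convex′ (sx + 1ℤ) sy j r∈P′ (UpRight-source p′)) p′
      where
      p′ = UpRight-restrict (beyond⇒∈ j) ≼-refl p

  nonneg-difference : ∀ {a b} → a ℤ.≤ b → ∃ λ j → b ≡ a + + j
  nonneg-difference {a} {b} a≤b =
    ℤ.∣ b - a ∣ ,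
    trans (sym (law a b)) (cong (λ d → a + d) (sym (ℤP.0≤i⇒+∣i∣≡i (ℤP.i≤j⇒0≤j-i a≤b))))
    where
    law : ∀ a b → a + (b - a) ≡ b
    law = solve-∀

  column-of-source : ∀ {P s} → Rooted P s → ∀ p → (proj₁ s , proj₂ s + + suc p) ∉ P →
                     ∀ {z} → z ∈ P → proj₁ z ≡ proj₁ s →
                     ∃ λ j → j ℕ.≤ p × z ≡ (proj₁ s , proj₂ s + + j)
  column-of-source {P} {sx , sy} R p top∉ {x , y} z∈P refl
    with nonneg-difference (proj₂ (UpRight⇒≼ (Rooted.reachable R z∈P)))
  ... | j , refl with j ℕ.≤? p
  ...   | yes j≤p = j , j≤p , refl
  ...   | no  j≰p = ⊥-elim (top∉ (Rooted.convex R x sy (sy + + j) (sy + + suc p) (Rooted.source∈P R) z∈P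
                      (ℤP.i≤i+j sy (+ suc p)) (ℤP.+-monoʳ-≤ sy (+≤+ (ℕP.≰⇒> j≰p)))))

  -ᶜ-column : ∀ x y j → (x , y + + j) -ᶜ (x , y) ≡ (0ℤ , + j)
  -ᶜ-column x y j = cong₂ _,_ (ℤP.+-inverseʳ x) (law y (+ j))
    where
    law : ∀ y t → y + t - y ≡ t
    law = solve-∀

  -ᶜ≡column⇒ : ∀ z s j → z -ᶜ s ≡ (0ℤ , + j) → z ≡ (proj₁ s , proj₂ s + + j)
  -ᶜ≡column⇒ z s@(sx , sy) j eq = begin
    z                         ≡⟨ -ᶜ+ᶜ z s ⟨
    (z -ᶜ s) +ᶜ s             ≡⟨ cong (_+ᶜ s) eq ⟩
    (0ℤ + sx , + j + sy)      ≡⟨ cong₂ _,_ (ℤP.+-identityˡ sx) (ℤP.+-comm (+ j) sy) ⟩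
    (sx , sy + + j)           ∎
    where open ≡-Reasoning

  encode-column : ∀ {P s c} p → Rooted P s →
                  (∀ j → j ℕ.≤ p → (proj₁ s , proj₂ s + + j) ∈ P) →
                  (proj₁ s , proj₂ s + + suc p) ∉ P →
                  Encodes (P withoutColumn proj₁ s) (right s) c → Encodes P s (column p c)
  encode-column {P} {s@(sx , sy)} {c} p R column∈ top∉ enc z = mk⇔ to from
    where
    to : z ∈ P → z -ᶜ s ∈ cells (column p c)
    to z∈P with proj₁ z ℤ.≟ sx
    ... | no z∉column = subst (_∈ cells (column p c)) (right-ᶜ z s)
          (right-∈-cells-column p c (Equivalence.to (enc z) (∈-filter⁺ _ z∈P z∉column)))
    ... | yes z∈column with column-of-source R p top∉ z∈P z∈column
    ...   | j , j≤p , refl = subst (_∈ cells (column p c)) (sym (-ᶜ-column sx sy j))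
                               (column-∈-cells-column p c j≤p)
    from : z -ᶜ s ∈ cells (column p c) → z ∈ P
    from z∈ with ∈-cells-column⁻ p c z∈
    ... | inj₂ (j , j≤p , eq) = subst (_∈ P) (sym (-ᶜ≡column⇒ z s j eq)) (column∈ j j≤p)
    ... | inj₁ (w , w∈ , eq) = proj₁ (∈-filter⁻ _ (Equivalence.from (enc z)
          (subst (_∈ cells c) (right-injective (trans (sym eq) (sym (right-ᶜ z s)))) w∈)))

  encode-acc : ∀ P s → Rooted P s → Acc ℕ._<_ (length P) → ∃ (Encodes P s)
  encode-acc P s R (acc rec) with right s ∈? P | above s ∈? P
  ... | no r∉P | no a∉P = single , encode-single R r∉P a∉P
  ... | no r∉P | yes a∈P
    with encode-acc (P without s) (above s) (without-source-rooted R r∉P a∈P)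
                    (rec (length-without (Rooted.source∈P R)))
  ...   | c , enc = under c , encode-under {c = c} (Rooted.source∈P R) enc
  encode-acc P s R (acc rec) | yes r∈P | _
    with column-top (proj₁ s) (proj₂ s) (Rooted.source∈P R)
       | encode-acc (P withoutColumn proj₁ s) (right s) (without-column-rooted R r∈P)
                    (rec (length-withoutColumn (Rooted.source∈P R)))
  ... | p , column∈ , top∉ | c , enc = column p c , encode-column {c = c} p R column∈ top∉ enc

  encode : ∀ P s → Rooted P s → ∃ (Encodes P s)
  encode P s R = encode-acc P s R (<-wellFounded (length P))


module Correspondence where
  open Codes
  open PermutationsOfCodes
  open DecodingPermutations
  open PermutationVectors
  open CellGeometry
  open UpRightPaths
  open CodeCells
  open Classification
  open import Data.Nat using (ℕ; _≤_)
  import Data.Nat.Properties as ℕP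
  open import Data.Fin using (Fin)
  open import Data.Vec using (Vec)
  open import Data.List using (map; length)
  open import Data.List.Membership.Propositional using (_∈_)
  open import Data.List.Membership.Propositional.Properties using (∈-map⁻)
  open import Data.List.Relation.Unary.Unique.Propositional using (Unique)
  import Data.List.Relation.Unary.Unique.Propositional.Properties as Unique
  open import Data.List.Properties using (length-map)
  open import Data.Product using (Σ; ∃; _×_; _,_; proj₁; proj₂)
  open import Relation.Binary.PropositionalEquality
  open import Function.Bundles using (mk⇔; Equivalence)
  open import Function using (id)

  translation-length≤ : ∀ {P Q} → Unique P → TranslationEquivalent P Q → length P ≤ length Q
  translation-length≤ {P} {Q} P! (a , b , P⇔Q) =
    subst (_≤ length Q) (length-map (_+ᶜ (a , b)) P)
      (unique-⊆⇒length≤ (Unique.map⁺ (+ᶜ-cancelʳ (a , b)) P!) image⊆Q)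
    where
    image⊆Q : ∀ {z} → z ∈ map (_+ᶜ (a , b)) P → z ∈ Q
    image⊆Q z∈ with ∈-map⁻ (_+ᶜ (a , b)) z∈
    ... | (x , y) , w∈P , refl = Equivalence.to (P⇔Q x y) w∈P

  translation-length : ∀ {P Q} → Unique P → Unique Q → TranslationEquivalent P Q → length P ≡ length Q
  translation-length P! Q! P≈Q =
    ℕP.≤-antisym (translation-length≤ P! P≈Q) (translation-length≤ Q! (translation-sym P≈Q))

  Encodes⇒translation : ∀ {P s c} → Encodes P s c → TranslationEquivalent (cells c) P
  Encodes⇒translation {P} {s} {c} enc = proj₁ s , proj₂ s , λ x y → mk⇔
    (λ z∈ → Equivalence.from (enc ((x , y) +ᶜ s)) (subst (_∈ cells c) (sym (+ᶜ-ᶜ (x , y) s)) z∈))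
    (λ z∈ → subst (_∈ cells c) (+ᶜ-ᶜ (x , y) s) (Equivalence.to (enc ((x , y) +ᶜ s)) z∈))

  DCCPolyomino-rooted : ∀ {n} (P : DCCPolyomino n) → ∃ (Rooted (proj₁ P))
  DCCPolyomino-rooted (P , _ , (L , b , L⇔P) , convex , _) = source b , record
    { source∈P  = Equivalence.to (L⇔P (source b)) (source-∈ b)
    ; convex    = convex
    ; reachable = λ {z} z∈P → UpRight-mono (λ {w} → Equivalence.to (L⇔P w))
                                (Built⇒UpRight b (Equivalence.from (L⇔P z) z∈P))
    }

  module _ {n} (P : DCCPolyomino n) where
    private
      root = DCCPolyomino-rooted P
      encoding = encode (proj₁ P) (proj₁ root) (proj₂ root)

    codeOf : Code
    codeOf = proj₁ encoding

    codeOf-translation : TranslationEquivalent (cells codeOf) (proj₁ P)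
    codeOf-translation = Encodes⇒translation {c = codeOf} (proj₂ encoding)

    size-codeOf : size codeOf ≡ n
    size-codeOf = begin
      size codeOf          ≡⟨ length-cells codeOf ⟨
      length (cells codeOf) ≡⟨ translation-length (cells-unique codeOf) (IsPolyomino.unique (proj₁ (proj₂ P)))
                                                   codeOf-translation ⟩
      length (proj₁ P)      ≡⟨ proj₂ (proj₂ (proj₂ (proj₂ P))) ⟩
      n                     ∎
      where open ≡-Reasoning

  polyomino : ∀ {n} c → size c ≡ n → DCCPolyomino n
  polyomino c size≡n =
    cells c ,
    record { unique = cells-unique c ; nonempty = origin , origin-∈-cells c ; connected = cells-connected c } ,
    (cells c , proj₁ (cells-built c) , λ _ → mk⇔ id id) ,
    cells-columnConvex c ,
    trans (length-cells c) size≡n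

  codeOf-polyomino : ∀ {n} c (size≡n : size c ≡ n) → codeOf (polyomino c size≡n) ≡ c
  codeOf-polyomino c size≡n = translation-rigid _ c (codeOf-translation (polyomino c size≡n))

  codeOf-respects-≈ : ∀ {n} (P Q : DCCPolyomino n) → P ≈P Q → codeOf P ≡ codeOf Q
  codeOf-respects-≈ P Q P≈Q = translation-rigid (codeOf P) (codeOf Q)
    (translation-trans (codeOf-translation P) (translation-trans P≈Q (translation-sym (codeOf-translation Q))))

  codeOf-reflects-≈ : ∀ {n} (P Q : DCCPolyomino n) → codeOf P ≡ codeOf Q → P ≈P Q
  codeOf-reflects-≈ P Q eq = translation-trans (translation-sym (codeOf-translation P))
    (subst (λ c → TranslationEquivalent (cells c) (proj₁ Q)) (sym eq) (codeOf-translation Q))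

  permutation : (n : ℕ) → Code → Vec (Fin n) n
  permutation n c = vector n (perm c)

  permutation-InS231-3124 : ∀ {n} c → size c ≡ n → InS231-3124 (permutation n c)
  permutation-InS231-3124 c refl = vector-InS231-3124 (perm-IsS231-3124 c)

  permutation-injective : ∀ {n} c c′ → size c ≡ n → size c′ ≡ n →
                          permutation n c ≡ permutation n c′ → c ≡ c′
  permutation-injective c c′ refl size≡ eq = perm-determines-code c c′ (sym size≡)
    (vector-injective (perm-bounded c) (subst (λ m → Bounded m (perm c′)) size≡ (perm-bounded c′)) eq)

  permutation-surjective : ∀ {n} (σ : Vec (Fin n) n) → 1 ≤ n → InS231-3124 σ →
                           ∃ λ c → size c ≡ n × permutation n c ≡ σ
  permutation-surjective {n} σ 1≤n σ∈S with decode n (valueAt σ) 1≤n (valueAt-IsS231-3124 σ σ∈S)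
  ... | c , size≡n , agree = c , size≡n , trans (vector-cong agree) (vector-valueAt σ)


open Correspondence

mainTheorem10 : (n : ℕ) → n ≥ 1 →
    Σ (DCCPolyomino n → Vec (Fin n) n) λ f →
    (∀ P → InS231-3124 (f P)) ×
    (∀ P Q → P ≈P Q → f P ≡ f Q) ×
    (∀ P Q → f P ≡ f Q → P ≈P Q) ×
    (∀ σ → InS231-3124 σ → ∃ λ P → f P ≡ σ)
mainTheorem10 n 1≤n = f , f-into , f-respects , f-reflects , f-onto
  where
  f : DCCPolyomino n → Vec (Fin n) n
  f P = permutation n (codeOf P)

  f-into : ∀ P → InS231-3124 (f P)
  f-into P = permutation-InS231-3124 (codeOf P) (size-codeOf P)

  f-respects : ∀ P Q → P ≈P Q → f P ≡ f Q
  f-respects P Q P≈Q = cong (permutation n) (codeOf-respects-≈ P Q P≈Q)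

  f-reflects : ∀ P Q → f P ≡ f Q → P ≈P Q
  f-reflects P Q eq =
    codeOf-reflects-≈ P Q (permutation-injective (codeOf P) (codeOf Q) (size-codeOf P) (size-codeOf Q) eq)

  f-onto : ∀ σ → InS231-3124 σ → ∃ λ P → f P ≡ σ
  f-onto σ σ∈S with permutation-surjective σ 1≤n σ∈S
  ... | c , size≡n , eq = polyomino c size≡n , trans (cong (permutation n) (codeOf-polyomino c size≡n)) eq
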